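{- Let $\mathsf{M}$ be a matroid without loops and coloops whose rank is $2$ or whose corank is $2$. Then $T_{\mathsf{M}}(2,0)\cdot T_{\mathsf{M}}(0,2)\geq T_{\mathsf{M}}(1,1)^2$.
   Context: $T_{\mathsf{M}}(x,y)$ denotes the Tutte polynomial of $\mathsf{M}$. The corank of a matroid on ground set $E$ of rank $k$ is $|E|-k$. -}

module Defs where

open import Data.Nat as ℕ using (ℕ; zero; suc; _<_; _∸_; _⊔_)
open import Data.Integer as ℤ using (ℤ; +_)
open import Data.Fin using (Fin)
open import Data.Fin.Subset using (Subset; _∈_; _∉_; _⊆_; ∣_∣; ⁅_⁆; _∪_; ⊥; ⊤; inside; outside)
open import Data.Fin.Subset.Properties using (_⊆?_)
open import Data.Vec using (_∷_; [])
open import Data.List using (List; []; _∷_; map; _++_; foldr)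
open import Data.Product using (Σ; ∃; _×_)
open import Relation.Binary.PropositionalEquality using (_≡_)
open import Relation.Nullary using (Dec; yes; no; ¬_)

record Matroid (n : ℕ) : Set₁ where
  field
    Indep        : Subset n → Set
    Indep?       : (A : Subset n) → Dec (Indep A)
    indep-empty  : Indep ⊥
    indep-hered  : ∀ A B → B ⊆ A → Indep A → Indep B
    indep-augment : ∀ A B → Indep A → Indep B → ∣ A ∣ < ∣ B ∣ →
                    ∃ λ e → e ∈ B × e ∉ A × Indep (⁅ e ⁆ ∪ A)

allSubsets : (n : ℕ) → List (Subset n)
allSubsets zero = [] ∷ []
allSubsets (suc n) = map (outside ∷_) (allSubsets n) ++ map (inside ∷_) (allSubsets n)

module _ {n : ℕ} (M : Matroid n) where
  open Matroid M

  rankOf : Subset n → ℕ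
  rankOf A = foldr step 0 (allSubsets n)
    where
    step : Subset n → ℕ → ℕ
    step B m with B ⊆? A | Indep? B
    ... | yes _ | yes _ = ∣ B ∣ ⊔ m
    ... | _     | _     = m

  rank : ℕ
  rank = rankOf ⊤

  corank : ℕ
  corank = n ∸ rank

  IsBasis : Subset n → Set
  IsBasis B = Indep B × (∀ C → B ⊆ C → Indep C → C ≡ B)

  IsLoop : Fin n → Set
  IsLoop e = ¬ Indep ⁅ e ⁆

  IsColoop : Fin n → Set
  IsColoop e = ∀ B → IsBasis B → e ∈ B

  tutte : ℤ → ℤ → ℤ
  tutte x y = foldr (λ A s → term A ℤ.+ s) (+ 0) (allSubsets n)
    where
    term : Subset n → ℤ
    term A = ((x ℤ.- + 1) ℤ.^ (rank ∸ rankOf A)) ℤ.* ((y ℤ.- + 1) ℤ.^ (∣ A ∣ ∸ rankOf A))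

module Submission where

-- A loopless matroid of rank 2 is determined by its parallel classes, of sizes a₁, …, a_k with
-- Σ aᵢ = n: a set has rank min(2, number of classes it meets).  Grouping the subsets in the
-- Tutte sum by the classes they meet gives
--   T(1,1) = C(n,2) − Σ C(aᵢ,2),   T(2,0) = 2k,   T(0,2) = 2ⁿ − 2 Σ (2^aᵢ − 1).
-- Rank 2 forces k ≥ 2, and having no coloops forces aᵢ ≥ 2 when k = 2.  The inequality is
-- then elementary: for k = 2 both sides factor (a² ≤ 2(2^a − 2)), for k = 3 use 3e₂ ≤ e₁²
-- and n⁴ + 108 ≤ 27·2ⁿ, and for k ≥ 4 use C(n,2)² ≤ 4·2ⁿ with the convexity bound on Σ 2^aᵢ.
-- In corank 2 the series classes play the same role, with x and y exchanged in T(x,y).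

open import Defs
open import Data.Nat using (ℕ)
open import Data.Fin using (Fin)
open import Relation.Binary using (DecidableEquality; Decidable; IsEquivalence)
open import Relation.Binary.PropositionalEquality using (_≡_)
open import Relation.Nullary using (¬_)

module Arithmetic where

  open import Data.Nat
  open import Data.Nat.Properties
  open import Data.Nat.Combinatorics using (_C_; nC1≡n; nCk+nC[k+1]≡[n+1]C[k+1])
  open import Data.Nat.Tactic.RingSolver using (solve-∀)
  open import Data.List using ([]; _∷_; length; map)
  open import Data.Nat.ListAction using (sum)
  open import Data.List.Relation.Unary.All using (All; []; _∷_)
  open import Data.Product using (∃₂; _×_; _,_)
  open import Data.Sum using (inj₁; inj₂)
  open import Relation.Binary.PropositionalEquality

  m+o≡n⇒m≤n : ∀ {m n} o → m + o ≡ n → m ≤ n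
  m+o≡n⇒m≤n {m} o refl = m≤m+n m o

  [1+n]C2≡nC2+n : ∀ n → suc n C 2 ≡ n C 2 + n
  [1+n]C2≡nC2+n n = begin
    suc n C 2      ≡⟨ nCk+nC[k+1]≡[n+1]C[k+1] n 1 ⟨
    n C 1 + n C 2  ≡⟨ cong (_+ n C 2) (nC1≡n n) ⟩
    n + n C 2      ≡⟨ +-comm n _ ⟩
    n C 2 + n      ∎
    where open ≡-Reasoning

  [m+n]C2 : ∀ m n → (m + n) C 2 ≡ m C 2 + n C 2 + m * n
  [m+n]C2 zero    n = sym (+-identityʳ (n C 2))
  [m+n]C2 (suc m) n = begin
    (suc m + n) C 2                  ≡⟨ [1+n]C2≡nC2+n (m + n) ⟩
    (m + n) C 2 + (m + n)            ≡⟨ cong (_+ (m + n)) ([m+n]C2 m n) ⟩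
    m C 2 + n C 2 + m * n + (m + n)  ≡⟨ regroup (m C 2) (n C 2) m n ⟩
    (m C 2 + m) + n C 2 + suc m * n  ≡⟨ cong (λ c → c + n C 2 + suc m * n) ([1+n]C2≡nC2+n m) ⟨
    suc m C 2 + n C 2 + suc m * n    ∎
    where
    open ≡-Reasoning
    regroup : ∀ a b m n → a + b + m * n + (m + n) ≡ (a + m) + b + suc m * n
    regroup = solve-∀

  2*[1+n]C2≡[1+n]*n : ∀ n → 2 * (suc n C 2) ≡ suc n * n
  2*[1+n]C2≡[1+n]*n zero    = refl
  2*[1+n]C2≡[1+n]*n (suc n) = begin
    2 * (suc (suc n) C 2)         ≡⟨ cong (2 *_) ([1+n]C2≡nC2+n (suc n)) ⟩
    2 * (suc n C 2 + suc n)       ≡⟨ *-distribˡ-+ 2 (suc n C 2) (suc n) ⟩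
    2 * (suc n C 2) + 2 * suc n   ≡⟨ cong (_+ 2 * suc n) (2*[1+n]C2≡[1+n]*n n) ⟩
    suc n * n + 2 * suc n         ≡⟨ expand n ⟩
    suc (suc n) * suc n           ∎
    where
    open ≡-Reasoning
    expand : ∀ n → suc n * n + 2 * suc n ≡ suc (suc n) * suc n
    expand = solve-∀

  ∑C2≤∑C2 : ∀ as → sum (map (_C 2) as) ≤ sum as C 2
  ∑C2≤∑C2 []       = z≤n
  ∑C2≤∑C2 (a ∷ as) = begin
    a C 2 + sum (map (_C 2) as)                ≤⟨ +-monoʳ-≤ (a C 2) (∑C2≤∑C2 as) ⟩
    a C 2 + sum as C 2                         ≤⟨ m≤m+n _ _ ⟩
    a C 2 + sum as C 2 + a * sum as            ≡⟨ [m+n]C2 a (sum as) ⟨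
    (a + sum as) C 2                           ∎
    where open ≤-Reasoning

  length≤sum : ∀ {as} → All (1 ≤_) as → length as ≤ sum as
  length≤sum []         = z≤n
  length≤sum (1≤a ∷ ps) = +-mono-≤ 1≤a (length≤sum ps)

  m+n≤m*n+1 : ∀ {m n} → 1 ≤ m → 1 ≤ n → m + n ≤ m * n + 1
  m+n≤m*n+1 {suc m} {suc n} _ _ = m+o≡n⇒m≤n (m * n) (expand m n)
    where
    expand : ∀ m n → suc m + suc n + m * n ≡ suc m * suc n + 1
    expand = solve-∀

  -- Equality holds when all sizes but one equal 1 (convexity of 2^a).
  ∑2^≤ : ∀ as → All (1 ≤_) as → 1 ≤ length as →
    sum (map (2 ^_) as) + 2 ≤ 2 * 2 ^ (sum as ∸ length as) + 2 * length as
  ∑2^≤ (zero ∷ _) (() ∷ _) _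
  ∑2^≤ (suc a ∷ []) _ _ = ≤-reflexive (begin
    2 ^ suc a + 0 + 2      ≡⟨ cong (_+ 2) (+-identityʳ (2 ^ suc a)) ⟩
    2 ^ suc a + 2          ≡⟨ cong (λ k → 2 ^ suc k + 2) (+-identityʳ a) ⟨
    2 ^ suc (a + 0) + 2    ∎)
    where open ≡-Reasoning
  ∑2^≤ (suc a ∷ b ∷ bs) (_ ∷ ps) _ = begin
    2 ^ suc a + S + 2                          ≡⟨ +-assoc (2 ^ suc a) S 2 ⟩
    2 ^ suc a + (S + 2)                        ≤⟨ +-monoʳ-≤ (2 ^ suc a) (∑2^≤ (b ∷ bs) ps (s≤s z≤n)) ⟩
    2 * u + (2 * v + 2 * k)                    ≡⟨ regroup₁ u v k ⟩
    2 * (u + v) + 2 * k                        ≤⟨ +-monoˡ-≤ (2 * k) (*-monoʳ-≤ 2 (m+n≤m*n+1 (m^n>0 2 a) (m^n>0 2 r))) ⟩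
    2 * (u * v + 1) + 2 * k                    ≡⟨ regroup₂ (u * v) k ⟩
    2 * (u * v) + 2 * suc k                    ≡⟨ cong (λ t → 2 * t + 2 * suc k) (^-distribˡ-+-* 2 a r) ⟨
    2 * 2 ^ (a + r) + 2 * suc k                ≡⟨ cong (λ t → 2 * 2 ^ t + 2 * suc k) (+-∸-assoc a (length≤sum ps)) ⟨
    2 * 2 ^ ((suc a + N) ∸ suc k) + 2 * suc k  ∎
    where
    open ≤-Reasoning
    N = sum (b ∷ bs)
    k = length (b ∷ bs)
    r = N ∸ k
    u = 2 ^ a
    v = 2 ^ r
    S = sum (map (2 ^_) (b ∷ bs))
    regroup₁ : ∀ u v k → 2 * u + (2 * v + 2 * k) ≡ 2 * (u + v) + 2 * k
    regroup₁ = solve-∀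
    regroup₂ : ∀ w k → 2 * (w + 1) + 2 * k ≡ 2 * w + 2 * suc k
    regroup₂ = solve-∀

  1+n≤2^n : ∀ n → 1 + n ≤ 2 ^ n
  1+n≤2^n zero    = s≤s z≤n
  1+n≤2^n (suc n) = begin
    2 + n          ≤⟨ s≤s (1+n≤2^n n) ⟩
    1 + 2 ^ n      ≤⟨ +-monoˡ-≤ (2 ^ n) (m^n>0 2 n) ⟩
    2 ^ n + 2 ^ n  ≡⟨ cong (2 ^ n +_) (+-identityʳ (2 ^ n)) ⟨
    2 ^ suc n      ∎
    where open ≤-Reasoning

  2≤2^n : ∀ {n} → 1 ≤ n → 2 ≤ 2 ^ n
  2≤2^n {n} 1≤n = ≤-trans (s≤s 1≤n) (1+n≤2^n n)

  n²+4≤2*2^n : ∀ {n} → 2 ≤ n → n * n + 4 ≤ 2 * 2 ^ n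
  n²+4≤2*2^n {suc (suc k)} (s≤s (s≤s _)) = from-two k
    where
    from-two : ∀ k → (2 + k) * (2 + k) + 4 ≤ 2 * 2 ^ (2 + k)
    from-two zero    = ≤-refl
    from-two (suc k) = begin
      (3 + k) * (3 + k) + 4                      ≤⟨ m+o≡n⇒m≤n 1 (expand k) ⟩
      ((2 + k) * (2 + k) + 4) + 2 * (3 + k)      ≤⟨ +-mono-≤ (from-two k) (*-monoʳ-≤ 2 (1+n≤2^n (2 + k))) ⟩
      2 * 2 ^ (2 + k) + 2 * 2 ^ (2 + k)          ≡⟨ double (2 ^ (2 + k)) ⟩
      2 * 2 ^ (3 + k)                            ∎
      where
      open ≤-Reasoning
      double : ∀ p → 2 * p + 2 * p ≡ 2 * (2 * p)
      double = solve-∀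
      expand : ∀ k → (3 + k) * (3 + k) + 4 + 1 ≡ ((2 + k) * (2 + k) + 4) + 2 * (3 + k)
      expand = solve-∀

  n²≤2*[2^n∸2] : ∀ {n} → 2 ≤ n → n * n ≤ 2 * (2 ^ n ∸ 2)
  n²≤2*[2^n∸2] {n} 2≤n = begin
    n * n            ≤⟨ m+n≤o⇒m≤o∸n (n * n) (n²+4≤2*2^n 2≤n) ⟩
    2 * 2 ^ n ∸ 4    ≡⟨ *-distribˡ-∸ 2 (2 ^ n) 2 ⟨
    2 * (2 ^ n ∸ 2)  ∎
    where open ≤-Reasoning

  2mn≤m²+n² : ∀ m n → 2 * (m * n) ≤ m * m + n * n
  2mn≤m²+n² m n with ≤-total m n
  ... | inj₁ m≤n = gap m (n ∸ m) (m+[n∸m]≡n m≤n)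
    where
    gap : ∀ m d {n} → m + d ≡ n → 2 * (m * n) ≤ m * m + n * n
    gap m d refl = m+o≡n⇒m≤n (d * d) (expand m d)
      where
      expand : ∀ m d → 2 * (m * (m + d)) + d * d ≡ m * m + (m + d) * (m + d)
      expand = solve-∀
  ... | inj₂ n≤m = gap n (m ∸ n) (m+[n∸m]≡n n≤m)
    where
    gap : ∀ n d {m} → n + d ≡ m → 2 * (m * n) ≤ m * m + n * n
    gap n d refl = m+o≡n⇒m≤n (d * d) (expand n d)
      where
      expand : ∀ n d → 2 * ((n + d) * n) + d * d ≡ (n + d) * (n + d) + n * n
      expand = solve-∀

  3e₂≤e₁² : ∀ a b c → 3 * (a * b + b * c + c * a) ≤ (a + b + c) * (a + b + c)
  3e₂≤e₁² a b c = *-cancelˡ-≤ 2 (begin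
    2 * (3 * (a * b + b * c + c * a))                                     ≡⟨ split a b c ⟩
    (2 * (a * b) + 2 * (b * c) + 2 * (c * a)) + 4 * (a * b + b * c + c * a)
      ≤⟨ +-monoˡ-≤ _ (+-mono-≤ (+-mono-≤ (2mn≤m²+n² a b) (2mn≤m²+n² b c)) (2mn≤m²+n² c a)) ⟩
    ((a * a + b * b) + (b * b + c * c) + (c * c + a * a)) + 4 * (a * b + b * c + c * a)
      ≡⟨ collect a b c ⟩
    2 * ((a + b + c) * (a + b + c))                                       ∎)
    where
    open ≤-Reasoning
    split : ∀ a b c → 2 * (3 * (a * b + b * c + c * a))
                    ≡ (2 * (a * b) + 2 * (b * c) + 2 * (c * a)) + 4 * (a * b + b * c + c * a)
    split = solve-∀
    collect : ∀ a b c → ((a * a + b * b) + (b * b + c * c) + (c * c + a * a)) + 4 * (a * b + b * c + c * a)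
                      ≡ 2 * ((a + b + c) * (a + b + c))
    collect = solve-∀

  n⁴+108≤27*2^n : ∀ {n} → 3 ≤ n → (n * n) * (n * n) + 108 ≤ 27 * 2 ^ n
  n⁴+108≤27*2^n {suc (suc (suc k))} (s≤s (s≤s (s≤s _))) = from-three k
    where
    from-three : ∀ k → ((3 + k) * (3 + k)) * ((3 + k) * (3 + k)) + 108 ≤ 27 * 2 ^ (3 + k)
    from-three 0 = ≤ᵇ⇒≤ 189 216 _
    from-three 1 = ≤ᵇ⇒≤ 364 432 _
    from-three 2 = ≤ᵇ⇒≤ 733 864 _
    from-three (suc (suc (suc k))) = begin
      ((6 + k) * (6 + k)) * ((6 + k) * (6 + k)) + 108
        ≤⟨ m+o≡n⇒m≤n (62 + 136 * k + 84 * (k * k) + 16 * (k * k * k) + k * k * k * k) (expand k) ⟩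
      2 * (((5 + k) * (5 + k)) * ((5 + k) * (5 + k)) + 108)  ≤⟨ *-monoʳ-≤ 2 (from-three (suc (suc k))) ⟩
      2 * (27 * 2 ^ (5 + k))                                   ≡⟨ swap (2 ^ (5 + k)) ⟩
      27 * 2 ^ (6 + k)                                         ∎
      where
      open ≤-Reasoning
      swap : ∀ p → 2 * (27 * p) ≡ 27 * (2 * p)
      swap = solve-∀
      expand : ∀ k → ((6 + k) * (6 + k)) * ((6 + k) * (6 + k)) + 108
                     + (62 + 136 * k + 84 * (k * k) + 16 * (k * k * k) + k * k * k * k)
                   ≡ 2 * (((5 + k) * (5 + k)) * ((5 + k) * (5 + k)) + 108)
      expand = solve-∀

  [nC2]²≤4*2^n : ∀ {n} → 4 ≤ n → (n C 2) * (n C 2) ≤ 4 * 2 ^ n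
  [nC2]²≤4*2^n {suc (suc (suc (suc k)))} (s≤s (s≤s (s≤s (s≤s _)))) = from-four k
    where
    next-square : ∀ k c → 2 * c ≡ (6 + k) * (5 + k) → (c + (6 + k)) * (c + (6 + k)) ≤ 2 * (c * c)
    next-square k c 2c≡ = *-cancelˡ-≤ 4 (begin
      4 * ((c + (6 + k)) * (c + (6 + k)))
        ≡⟨ scale c (6 + k) ⟩
      (2 * c + 2 * (6 + k)) * (2 * c + 2 * (6 + k))
        ≡⟨ cong (λ t → (t + 2 * (6 + k)) * (t + 2 * (6 + k))) 2c≡ ⟩
      ((6 + k) * (5 + k) + 2 * (6 + k)) * ((6 + k) * (5 + k) + 2 * (6 + k))
        ≤⟨ m+o≡n⇒m≤n ((6 + k) * (6 + k) * (1 + 6 * k + k * k)) (expand k) ⟩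
      2 * (((6 + k) * (5 + k)) * ((6 + k) * (5 + k)))
        ≡⟨ cong (λ t → 2 * (t * t)) 2c≡ ⟨
      2 * ((2 * c) * (2 * c))
        ≡⟨ rescale c ⟩
      4 * (2 * (c * c))
        ∎)
      where
      open ≤-Reasoning
      scale : ∀ c m → 4 * ((c + m) * (c + m)) ≡ (2 * c + 2 * m) * (2 * c + 2 * m)
      scale = solve-∀
      rescale : ∀ c → 2 * ((2 * c) * (2 * c)) ≡ 4 * (2 * (c * c))
      rescale = solve-∀
      expand : ∀ k → ((6 + k) * (5 + k) + 2 * (6 + k)) * ((6 + k) * (5 + k) + 2 * (6 + k))
                     + (6 + k) * (6 + k) * (1 + 6 * k + k * k)
                   ≡ 2 * (((6 + k) * (5 + k)) * ((6 + k) * (5 + k)))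
      expand = solve-∀

    from-four : ∀ k → ((4 + k) C 2) * ((4 + k) C 2) ≤ 4 * 2 ^ (4 + k)
    from-four 0 = ≤ᵇ⇒≤ 36 64 _
    from-four 1 = ≤ᵇ⇒≤ 100 128 _
    from-four 2 = ≤ᵇ⇒≤ 225 256 _
    from-four (suc (suc (suc k))) = begin
      ((7 + k) C 2) * ((7 + k) C 2)               ≡⟨ cong (λ t → t * t) ([1+n]C2≡nC2+n (6 + k)) ⟩
      (c + (6 + k)) * (c + (6 + k))               ≤⟨ next-square k c (2*[1+n]C2≡[1+n]*n (5 + k)) ⟩
      2 * (c * c)                                 ≤⟨ *-monoʳ-≤ 2 (from-four (suc (suc k))) ⟩
      2 * (4 * 2 ^ (6 + k))                       ≡⟨ swap (2 ^ (6 + k)) ⟩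
      4 * 2 ^ (7 + k)                             ∎
      where
      open ≤-Reasoning
      c = (6 + k) C 2
      swap : ∀ p → 2 * (4 * p) ≡ 4 * (2 * p)
      swap = solve-∀

  4Q≤2^[K+r] : ∀ {K r Q} → 4 ≤ K → Q + K + 2 ≤ 2 * 2 ^ r + 2 * K → 4 * Q ≤ 2 ^ (K + r)
  4Q≤2^[K+r] {suc (suc (suc (suc j)))} {r} {Q} (s≤s (s≤s (s≤s (s≤s _)))) hyp = begin
    4 * Q                         ≤⟨ +-cancelʳ-≤ (24 + 4 * j) (4 * Q) (8 * v + (8 + 4 * j)) scaled ⟩
    8 * v + (8 + 4 * j)           ≤⟨ +-mono-≤ (*-monoʳ-≤ 8 v≤uv)
                                       (≤-trans (m+o≡n⇒m≤n (4 * j) (expand j)) (*-monoʳ-≤ 8 1+j≤uv)) ⟩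
    8 * (u * v) + 8 * (u * v)     ≡⟨ sixteen (u * v) ⟩
    2 ^ 4 * (u * v)               ≡⟨ cong (2 ^ 4 *_) (^-distribˡ-+-* 2 j r) ⟨
    2 ^ 4 * 2 ^ (j + r)           ≡⟨ ^-distribˡ-+-* 2 4 (j + r) ⟨
    2 ^ (4 + j + r)               ∎
    where
    open ≤-Reasoning
    u = 2 ^ j
    v = 2 ^ r
    sixteen : ∀ w → 8 * w + 8 * w ≡ 16 * w
    sixteen = solve-∀
    expand : ∀ j → 8 + 4 * j + 4 * j ≡ 8 * (1 + j)
    expand = solve-∀
    v≤uv : v ≤ u * v
    v≤uv = m≤n*m v u {{m^n≢0 2 j}}
    1+j≤uv : 1 + j ≤ u * v
    1+j≤uv = ≤-trans (1+n≤2^n j) (m≤m*n u v {{m^n≢0 2 r}})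
    scaled : 4 * Q + (24 + 4 * j) ≤ 8 * v + (8 + 4 * j) + (24 + 4 * j)
    scaled = begin
      4 * Q + (24 + 4 * j)                    ≡⟨ factor Q j ⟩
      4 * (Q + (4 + j) + 2)                   ≤⟨ *-monoʳ-≤ 4 hyp ⟩
      4 * (2 * v + 2 * (4 + j))               ≡⟨ regroup v j ⟩
      8 * v + (8 + 4 * j) + (24 + 4 * j)      ∎
      where
      factor : ∀ Q j → 4 * Q + (24 + 4 * j) ≡ 4 * (Q + (4 + j) + 2)
      factor = solve-∀
      regroup : ∀ v j → 4 * (2 * v + 2 * (4 + j)) ≡ 8 * v + (8 + 4 * j) + (24 + 4 * j)
      regroup = solve-∀

  -- (n C 2 ∸ P)² ≤ x (2ⁿ ∸ 2Q), with both differences exhibited as naturals.  For a rank-2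
  -- matroid with P parallel pairs and Q nonempty sets of parallel elements these are
  -- T(1,1)² and T(2,0) T(0,2), where x = T(2,0).
  SquareBound : ℕ → ℕ → ℕ → ℕ → Set
  SquareBound n P Q x = ∃₂ λ m y → P + m ≡ n C 2 × 2 * Q + y ≡ 2 ^ n × m * m ≤ x * y

  two-classes-bound : ∀ {a b n P Q x} → 2 ≤ a → 2 ≤ b → n ≡ a + b → P ≡ a C 2 + b C 2 →
    Q + 2 ≡ 2 ^ a + 2 ^ b → 4 ≤ x → SquareBound n P Q x
  two-classes-bound {a} {b} {Q = Q} {x} 2≤a 2≤b refl refl hQ 4≤x =
    a * b , U * V , sym ([m+n]C2 a b) , powers , square
    where
    U = 2 ^ a ∸ 2
    V = 2 ^ b ∸ 2
    2+U≡2^a : 2 + U ≡ 2 ^ a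
    2+U≡2^a = m+[n∸m]≡n (2≤2^n (≤-trans (s≤s z≤n) 2≤a))
    2+V≡2^b : 2 + V ≡ 2 ^ b
    2+V≡2^b = m+[n∸m]≡n (2≤2^n (≤-trans (s≤s z≤n) 2≤b))
    Q≡2+U+V : Q ≡ 2 + U + V
    Q≡2+U+V = +-cancelʳ-≡ 2 Q (2 + U + V)
      (trans hQ (trans (cong₂ _+_ (sym 2+U≡2^a) (sym 2+V≡2^b)) (regroup U V)))
      where
      regroup : ∀ u v → 2 + u + (2 + v) ≡ 2 + u + v + 2
      regroup = solve-∀
    powers : 2 * Q + U * V ≡ 2 ^ (a + b)
    powers = begin
      2 * Q + U * V            ≡⟨ cong (λ q → 2 * q + U * V) Q≡2+U+V ⟩
      2 * (2 + U + V) + U * V  ≡⟨ factor U V ⟩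
      (2 + U) * (2 + V)        ≡⟨ cong₂ _*_ 2+U≡2^a 2+V≡2^b ⟩
      2 ^ a * 2 ^ b            ≡⟨ ^-distribˡ-+-* 2 a b ⟨
      2 ^ (a + b)              ∎
      where
      open ≡-Reasoning
      factor : ∀ u v → 2 * (2 + u + v) + u * v ≡ (2 + u) * (2 + v)
      factor = solve-∀
    square : a * b * (a * b) ≤ x * (U * V)
    square = begin
      a * b * (a * b)    ≡⟨ interchange a b ⟩
      (a * a) * (b * b)  ≤⟨ *-mono-≤ (n²≤2*[2^n∸2] 2≤a) (n²≤2*[2^n∸2] 2≤b) ⟩
      (2 * U) * (2 * V)  ≡⟨ regroup U V ⟩
      4 * (U * V)        ≤⟨ *-monoˡ-≤ (U * V) 4≤x ⟩
      x * (U * V)        ∎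
      where
      open ≤-Reasoning
      regroup : ∀ u v → (2 * u) * (2 * v) ≡ 4 * (u * v)
      regroup = solve-∀
      interchange : ∀ a b → a * b * (a * b) ≡ (a * a) * (b * b)
      interchange = solve-∀

  three-classes-bound : ∀ {a b c n P Q x} → 1 ≤ a → 1 ≤ b → 1 ≤ c → n ≡ a + (b + c) →
    P ≡ a C 2 + (b C 2 + c C 2) → Q + 3 + 2 ≤ 2 * 2 ^ (n ∸ 3) + 2 * 3 → 6 ≤ x → SquareBound n P Q x
  three-classes-bound {suc a′} {suc b′} {suc c′} {Q = Q} {x} _ _ _ refl refl hQ 6≤x = m , y , pairs , powers , square
    where
    a = suc a′
    b = suc b′
    c = suc c′
    n = a + (b + c)
    r = a′ + (b′ + c′)
    n≡3+r : n ≡ 3 + r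
    n≡3+r = pull a′ b′ c′
      where
      pull : ∀ a b c → suc a + (suc b + suc c) ≡ 3 + (a + (b + c))
      pull = solve-∀
    v = 2 ^ r
    m = a * b + b * c + c * a
    pairs : a C 2 + (b C 2 + c C 2) + m ≡ n C 2
    pairs = sym (begin
      n C 2                                          ≡⟨ [m+n]C2 a (b + c) ⟩
      a C 2 + (b + c) C 2 + a * (b + c)              ≡⟨ cong (λ t → a C 2 + t + a * (b + c)) ([m+n]C2 b c) ⟩
      a C 2 + (b C 2 + c C 2 + b * c) + a * (b + c)  ≡⟨ regroup (a C 2) (b C 2) (c C 2) a b c ⟩
      a C 2 + (b C 2 + c C 2) + m                    ∎)
      where
      open ≡-Reasoning
      regroup : ∀ x y z a b c → x + (y + z + b * c) + a * (b + c) ≡ x + (y + z) + (a * b + b * c + c * a)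
      regroup = solve-∀
    2^n≡8v : 2 ^ n ≡ 8 * v
    2^n≡8v = trans (cong (2 ^_) n≡3+r) (^-distribˡ-+-* 2 3 r)
    2Q≤4v+2 : 2 * Q ≤ 4 * v + 2
    2Q≤4v+2 = +-cancelʳ-≤ 10 (2 * Q) (4 * v + 2) (begin
      2 * Q + 10                  ≡⟨ factor Q ⟩
      2 * (Q + 3 + 2)             ≤⟨ *-monoʳ-≤ 2 hQ ⟩
      2 * (2 * 2 ^ (n ∸ 3) + 6)   ≡⟨ cong (λ t → 2 * (2 * 2 ^ (t ∸ 3) + 6)) n≡3+r ⟩
      2 * (2 * v + 6)             ≡⟨ regroup v ⟩
      4 * v + 2 + 10              ∎)
      where
      open ≤-Reasoning
      factor : ∀ q → 2 * q + 10 ≡ 2 * (q + 3 + 2)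
      factor = solve-∀
      regroup : ∀ v → 2 * (2 * v + 6) ≡ 4 * v + 2 + 10
      regroup = solve-∀
    2Q≤2^n : 2 * Q ≤ 2 ^ n
    2Q≤2^n = begin
      2 * Q          ≤⟨ 2Q≤4v+2 ⟩
      4 * v + 2      ≤⟨ +-monoʳ-≤ (4 * v) (*-monoʳ-≤ 2 (m^n>0 2 r)) ⟩
      4 * v + 2 * v  ≤⟨ +-monoʳ-≤ (4 * v) (*-monoˡ-≤ v (≤ᵇ⇒≤ 2 4 _)) ⟩
      4 * v + 4 * v  ≡⟨ double v ⟩
      8 * v          ≡⟨ 2^n≡8v ⟨
      2 ^ n          ∎
      where
      open ≤-Reasoning
      double : ∀ v → 4 * v + 4 * v ≡ 8 * v
      double = solve-∀
    y = 2 ^ n ∸ 2 * Q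
    powers : 2 * Q + y ≡ 2 ^ n
    powers = m+[n∸m]≡n 2Q≤2^n
    4v≤2+y : 4 * v ≤ 2 + y
    4v≤2+y = +-cancelˡ-≤ (4 * v) (4 * v) (2 + y) (begin
      4 * v + 4 * v    ≡⟨ double v ⟩
      8 * v            ≡⟨ 2^n≡8v ⟨
      2 ^ n            ≡⟨ powers ⟨
      2 * Q + y        ≤⟨ +-monoˡ-≤ y 2Q≤4v+2 ⟩
      4 * v + 2 + y    ≡⟨ +-assoc (4 * v) 2 y ⟩
      4 * v + (2 + y)  ∎)
      where
      open ≤-Reasoning
      double : ∀ v → 4 * v + 4 * v ≡ 8 * v
      double = solve-∀
    9m²≤n⁴ : 9 * (m * m) ≤ (n * n) * (n * n)
    9m²≤n⁴ = begin
      9 * (m * m)                                        ≡⟨ nine m ⟩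
      (3 * m) * (3 * m)                                  ≤⟨ *-mono-≤ (3e₂≤e₁² a b c) (3e₂≤e₁² a b c) ⟩
      ((a + b + c) * (a + b + c)) * ((a + b + c) * (a + b + c))
        ≡⟨ cong (λ t → (t * t) * (t * t)) (+-assoc a b c) ⟩
      (n * n) * (n * n)                                  ∎
      where
      open ≤-Reasoning
      nine : ∀ m → 9 * (m * m) ≡ (3 * m) * (3 * m)
      nine = solve-∀
    square : m * m ≤ x * y
    square = ≤-trans (*-cancelˡ-≤ 9 (+-cancelʳ-≤ 108 _ _ (begin
      9 * (m * m) + 108          ≤⟨ +-monoˡ-≤ 108 9m²≤n⁴ ⟩
      (n * n) * (n * n) + 108    ≤⟨ n⁴+108≤27*2^n (subst (3 ≤_) (sym n≡3+r) (m≤m+n 3 r)) ⟩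
      27 * 2 ^ n                 ≡⟨ cong (27 *_) 2^n≡8v ⟩
      27 * (8 * v)               ≡⟨ regroup v ⟩
      54 * (4 * v)               ≤⟨ *-monoʳ-≤ 54 4v≤2+y ⟩
      54 * (2 + y)               ≡⟨ split y ⟩
      9 * (6 * y) + 108          ∎))) (*-monoˡ-≤ y 6≤x)
      where
      open ≤-Reasoning
      regroup : ∀ v → 27 * (8 * v) ≡ 54 * (4 * v)
      regroup = solve-∀
      split : ∀ y → 54 * (2 + y) ≡ 9 * (6 * y) + 108
      split = solve-∀

  many-classes-bound : ∀ {K n P Q x} → 4 ≤ K → K ≤ n → Q + K + 2 ≤ 2 * 2 ^ (n ∸ K) + 2 * K →
    P ≤ n C 2 → 8 ≤ x → SquareBound n P Q x
  many-classes-bound {K} {n} {P} {Q} {x} 4≤K K≤n hQ P≤ 8≤x = n C 2 ∸ P , y , m+[n∸m]≡n P≤ , powers , square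
    where
    4Q≤2^n : 4 * Q ≤ 2 ^ n
    4Q≤2^n = subst (λ t → 4 * Q ≤ 2 ^ t) (m+[n∸m]≡n K≤n) (4Q≤2^[K+r] 4≤K hQ)
    y = 2 ^ n ∸ 2 * Q
    powers : 2 * Q + y ≡ 2 ^ n
    powers = m+[n∸m]≡n (≤-trans (*-monoˡ-≤ Q (≤ᵇ⇒≤ 2 4 _)) 4Q≤2^n)
    2Q≤y : 2 * Q ≤ y
    2Q≤y = +-cancelˡ-≤ (2 * Q) (2 * Q) y (begin
      2 * Q + 2 * Q  ≡⟨ double Q ⟩
      4 * Q          ≤⟨ 4Q≤2^n ⟩
      2 ^ n          ≡⟨ powers ⟨
      2 * Q + y      ∎)
      where
      open ≤-Reasoning
      double : ∀ q → 2 * q + 2 * q ≡ 4 * q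
      double = solve-∀
    square : (n C 2 ∸ P) * (n C 2 ∸ P) ≤ x * y
    square = begin
      (n C 2 ∸ P) * (n C 2 ∸ P)  ≤⟨ *-mono-≤ (m∸n≤m (n C 2) P) (m∸n≤m (n C 2) P) ⟩
      (n C 2) * (n C 2)          ≤⟨ [nC2]²≤4*2^n (≤-trans 4≤K K≤n) ⟩
      4 * 2 ^ n                  ≡⟨ cong (4 *_) powers ⟨
      4 * (2 * Q + y)            ≤⟨ *-monoʳ-≤ 4 (+-monoˡ-≤ y 2Q≤y) ⟩
      4 * (y + y)                ≡⟨ double y ⟩
      8 * y                      ≤⟨ *-monoˡ-≤ y 8≤x ⟩
      x * y                      ∎
      where
      open ≤-Reasoning
      double : ∀ y → 4 * (y + y) ≡ 8 * y
      double = solve-∀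

  class-sizes-bound : ∀ as {n P Q x} → All (1 ≤_) as → (length as ≡ 2 → All (2 ≤_) as) → 2 ≤ length as →
    n ≡ sum as → P ≡ sum (map (_C 2) as) → Q + length as ≡ sum (map (2 ^_) as) → 2 * length as ≤ x →
    SquareBound n P Q x
  class-sizes-bound (_ ∷ []) _ _ (s≤s ())
  class-sizes-bound (a ∷ b ∷ []) _ two-only _ refl refl Q≡ 4≤x with two-only refl
  ... | 2≤a ∷ 2≤b ∷ [] = two-classes-bound 2≤a 2≤b
    (cong (a +_) (+-identityʳ b)) (cong (a C 2 +_) (+-identityʳ (b C 2)))
    (trans Q≡ (cong (2 ^ a +_) (+-identityʳ (2 ^ b)))) 4≤x
  class-sizes-bound as@(a ∷ b ∷ c ∷ []) ps@(1≤a ∷ 1≤b ∷ 1≤c ∷ []) _ _ refl refl Q≡ 6≤x =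
    three-classes-bound 1≤a 1≤b 1≤c
      (cong (λ t → a + (b + t)) (+-identityʳ c)) (cong (λ t → a C 2 + (b C 2 + t)) (+-identityʳ (c C 2)))
      (subst (λ t → t + 2 ≤ 2 * 2 ^ (sum as ∸ length as) + 2 * length as) (sym Q≡) (∑2^≤ as ps (s≤s z≤n))) 6≤x
  class-sizes-bound as@(_ ∷ _ ∷ _ ∷ _ ∷ _) ps _ _ refl refl Q≡ 2K≤x =
    many-classes-bound (s≤s (s≤s (s≤s (s≤s z≤n)))) (length≤sum ps)
      (subst (λ t → t + 2 ≤ 2 * 2 ^ (sum as ∸ length as) + 2 * length as) (sym Q≡) (∑2^≤ as ps (s≤s z≤n)))
      (∑C2≤∑C2 as)
      (≤-trans (*-monoʳ-≤ 2 (s≤s (s≤s (s≤s (s≤s z≤n))))) 2K≤x)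

  complement-exponents : ∀ {R r a c p} → a + c ≡ R + 2 → r + (2 ∸ p) ≡ a → p ≤ c → p ≤ 2 →
    R ∸ r ≡ c ∸ p × a ∸ r ≡ 2 ∸ p
  complement-exponents {R} {r} {a} {c} {p} a+c≡ r+[2∸p]≡a p≤c p≤2 = R∸r≡ , a∸r≡
    where
    open ≡-Reasoning
    a∸r≡ : a ∸ r ≡ 2 ∸ p
    a∸r≡ = trans (cong (_∸ r) (sym r+[2∸p]≡a)) (m+n∸m≡n r (2 ∸ p))
    r+[c∸p]≡R : r + (c ∸ p) ≡ R
    r+[c∸p]≡R = +-cancelʳ-≡ 2 _ _ (begin
      r + (c ∸ p) + 2        ≡⟨ +-assoc r (c ∸ p) 2 ⟩
      r + (c ∸ p + 2)        ≡⟨ cong (_+_ r) (trans (sym (+-∸-comm 2 p≤c)) (cong (_∸ p) (+-comm c 2))) ⟩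
      r + (2 + c ∸ p)        ≡⟨ cong (_+_ r) (+-∸-comm c p≤2) ⟩
      r + ((2 ∸ p) + c)      ≡⟨ +-assoc r (2 ∸ p) c ⟨
      r + (2 ∸ p) + c        ≡⟨ cong (_+ c) r+[2∸p]≡a ⟩
      a + c                  ≡⟨ a+c≡ ⟩
      R + 2                  ∎)
    R∸r≡ : R ∸ r ≡ c ∸ p
    R∸r≡ = trans (cong (_∸ r) (sym r+[c∸p]≡R)) (m+n∸m≡n r (c ∸ p))

module SubsetSums where

  open import Data.Nat using (ℕ; zero; suc)
  open import Data.Nat.Combinatorics using (_C_; nCk+nC[k+1]≡[n+1]C[k+1])
  open import Data.Integer using (ℤ; +_; _+_; _*_; -_; _^_)
  open import Data.Integer.Properties
  open import Data.Integer.Tactic.RingSolver using (solve-∀)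
  open import Data.Fin.Subset using (Subset; inside; outside; ∣_∣; ∁)
  open import Data.List using (List; []; _∷_; map; _++_; foldr)
  open import Data.Vec using (_∷_)
  open import Function using (_∘_)
  open import Relation.Binary.PropositionalEquality

  module _ {n : ℕ} where

    sumOver : (Subset n → ℤ) → List (Subset n) → ℤ
    sumOver f = foldr (λ A s → f A + s) (+ 0)

    sumOver-++ : ∀ f xs ys → sumOver f (xs ++ ys) ≡ sumOver f xs + sumOver f ys
    sumOver-++ f []       ys = sym (+-identityˡ _)
    sumOver-++ f (x ∷ xs) ys = trans (cong (_+_ (f x)) (sumOver-++ f xs ys)) (sym (+-assoc (f x) _ _))

    sumOver-0 : ∀ xs → sumOver (λ _ → + 0) xs ≡ + 0
    sumOver-0 []       = refl
    sumOver-0 (x ∷ xs) = trans (+-identityˡ _) (sumOver-0 xs)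

    sumOver-cong : ∀ {f g} → (∀ A → f A ≡ g A) → ∀ xs → sumOver f xs ≡ sumOver g xs
    sumOver-cong f≗g []       = refl
    sumOver-cong f≗g (x ∷ xs) = cong₂ _+_ (f≗g x) (sumOver-cong f≗g xs)

    sumOver-+ : ∀ f g xs → sumOver (λ A → f A + g A) xs ≡ sumOver f xs + sumOver g xs
    sumOver-+ f g []       = refl
    sumOver-+ f g (x ∷ xs) = trans (cong (_+_ (f x + g x)) (sumOver-+ f g xs)) (interchange (f x) (g x) _ _)
      where
      interchange : ∀ a b c d → (a + b) + (c + d) ≡ (a + c) + (b + d)
      interchange = solve-∀

    sumOver-* : ∀ c f xs → sumOver (λ A → c * f A) xs ≡ c * sumOver f xs
    sumOver-* c f []       = sym (*-zeroʳ c)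
    sumOver-* c f (x ∷ xs) = trans (cong (_+_ (c * f x)) (sumOver-* c f xs)) (sym (*-distribˡ-+ c (f x) _))

  sumOver-map : ∀ {m n} (f : Subset n → ℤ) (g : Subset m → Subset n) xs →
    sumOver f (map g xs) ≡ sumOver (f ∘ g) xs
  sumOver-map f g []       = refl
  sumOver-map f g (x ∷ xs) = cong (_+_ (f (g x))) (sumOver-map f g xs)

  sumSubsets : ∀ {n} → (Subset n → ℤ) → ℤ
  sumSubsets {n} f = sumOver f (allSubsets n)

  module _ {n : ℕ} where

    sumSubsets-suc : ∀ (f : Subset (suc n) → ℤ) →
      sumSubsets f ≡ sumSubsets (λ A → f (outside ∷ A)) + sumSubsets (λ A → f (inside ∷ A))
    sumSubsets-suc f = trans (sumOver-++ f (map (outside ∷_) (allSubsets n)) (map (inside ∷_) (allSubsets n)))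
      (cong₂ _+_ (sumOver-map f (outside ∷_) (allSubsets n)) (sumOver-map f (inside ∷_) (allSubsets n)))

    sumSubsets-cong : ∀ {f g : Subset n → ℤ} → (∀ A → f A ≡ g A) → sumSubsets f ≡ sumSubsets g
    sumSubsets-cong f≗g = sumOver-cong f≗g (allSubsets n)

    sumSubsets-+ : ∀ (f g : Subset n → ℤ) → sumSubsets (λ A → f A + g A) ≡ sumSubsets f + sumSubsets g
    sumSubsets-+ f g = sumOver-+ f g (allSubsets n)

    sumSubsets-* : ∀ c (f : Subset n → ℤ) → sumSubsets (λ A → c * f A) ≡ c * sumSubsets f
    sumSubsets-* c f = sumOver-* c f (allSubsets n)

  sumSubsets-∁ : ∀ {n} (f : Subset n → ℤ) → sumSubsets f ≡ sumSubsets (f ∘ ∁)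
  sumSubsets-∁ {zero}  f = refl
  sumSubsets-∁ {suc n} f = begin
    sumSubsets f
      ≡⟨ sumSubsets-suc f ⟩
    sumSubsets (λ A → f (outside ∷ A)) + sumSubsets (λ A → f (inside ∷ A))
      ≡⟨ cong₂ _+_ (sumSubsets-∁ (λ A → f (outside ∷ A))) (sumSubsets-∁ (λ A → f (inside ∷ A))) ⟩
    sumSubsets (λ A → f (outside ∷ ∁ A)) + sumSubsets (λ A → f (inside ∷ ∁ A))
      ≡⟨ +-comm (sumSubsets (λ A → f (outside ∷ ∁ A))) _ ⟩
    sumSubsets (λ A → f (inside ∷ ∁ A)) + sumSubsets (λ A → f (outside ∷ ∁ A))
      ≡⟨ sumSubsets-suc (f ∘ ∁) ⟨
    sumSubsets (f ∘ ∁)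
      ∎
    where open ≡-Reasoning

  sumSubsets-^ : ∀ n (z : ℤ) → sumSubsets {n} (λ A → z ^ ∣ A ∣) ≡ (+ 1 + z) ^ n
  sumSubsets-^ zero    z = refl
  sumSubsets-^ (suc n) z = begin
    sumSubsets {suc n} (λ A → z ^ ∣ A ∣)          ≡⟨ sumSubsets-suc {n} (λ A → z ^ ∣ A ∣) ⟩
    Σz + sumSubsets {n} (λ A → z * z ^ ∣ A ∣)     ≡⟨ cong (_+_ Σz) (sumSubsets-* {n} z (λ A → z ^ ∣ A ∣)) ⟩
    Σz + z * Σz                                   ≡⟨ cong (λ t → t + z * t) (sumSubsets-^ n z) ⟩
    (+ 1 + z) ^ n + z * (+ 1 + z) ^ n             ≡⟨ factor ((+ 1 + z) ^ n) z ⟩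
    (+ 1 + z) * (+ 1 + z) ^ n                     ∎
    where
    open ≡-Reasoning
    Σz = sumSubsets {n} (λ A → z ^ ∣ A ∣)
    factor : ∀ a z → a + z * a ≡ (+ 1 + z) * a
    factor = solve-∀

  δ : ℕ → ℕ → ℤ
  δ zero    zero    = + 1
  δ zero    (suc _) = + 0
  δ (suc _) zero    = + 0
  δ (suc k) (suc s) = δ k s

  sumSubsets-δ : ∀ n k → sumSubsets {n} (λ A → δ k ∣ A ∣) ≡ + (n C k)
  sumSubsets-δ zero    zero    = refl
  sumSubsets-δ zero    (suc k) = refl
  sumSubsets-δ (suc n) zero    = trans (sumSubsets-suc {n} (λ A → δ 0 ∣ A ∣))
    (cong₂ _+_ (sumSubsets-δ n 0) (sumOver-0 (allSubsets n)))
  sumSubsets-δ (suc n) (suc k) = begin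
    sumSubsets {suc n} (λ A → δ (suc k) ∣ A ∣)  ≡⟨ sumSubsets-suc {n} (λ A → δ (suc k) ∣ A ∣) ⟩
    sumSubsets {n} (λ A → δ (suc k) ∣ A ∣) + sumSubsets {n} (λ A → δ k ∣ A ∣)
                                                ≡⟨ cong₂ _+_ (sumSubsets-δ n (suc k)) (sumSubsets-δ n k) ⟩
    + (n C suc k) + + (n C k)                   ≡⟨ +-comm (+ (n C suc k)) (+ (n C k)) ⟩
    + (n C k) + + (n C suc k)                   ≡⟨ cong +_ (nCk+nC[k+1]≡[n+1]C[k+1] n k) ⟩
    + (suc n C suc k)                           ∎
    where open ≡-Reasoning

module Colouring {Colour : Set} (_≟_ : DecidableEquality Colour) where

  open import Data.Nat as ℕ using (ℕ; zero; suc; _∸_; _≤_; s≤s; z≤n)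
  import Data.Nat.Properties as ℕ
  open import Data.Nat.Combinatorics using (_C_; nC1≡n; nCk+nC[k+1]≡[n+1]C[k+1])
  open import Data.Integer using (ℤ; +_; -[1+_]; _+_; _*_; -_; _^_)
  open import Data.Integer.Properties hiding (_≟_)
  open import Data.Integer.Tactic.RingSolver using (solve-∀)
  open import Data.Fin using (Fin; zero; suc)
  open import Data.Fin.Subset using (Subset; inside; outside; ∣_∣; _∈_; Empty; Nonempty)
  open import Data.Vec using ([]; _∷_; here; there)
  open import Data.List using (List; []; _∷_; length)
  open import Function using (_∘_; id)
  open import Relation.Binary.PropositionalEquality
  open import Relation.Nullary using (Dec; yes; no; ¬_)
  open import Data.Empty using (⊥-elim)
  open import Data.Product using (∃₂; _×_; _,_)
  open SubsetSums

  pos-^ : ∀ m n → + (m ℕ.^ n) ≡ (+ m) ^ n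
  pos-^ m zero    = refl
  pos-^ m (suc n) = trans (pos-* m (m ℕ.^ n)) (cong (+ m *_) (pos-^ m n))

  𝟙 : ∀ {P : Set} → Dec P → ℕ
  𝟙 (yes _) = 1
  𝟙 (no _)  = 0

  𝟙-yes : ∀ {P : Set} (d : Dec P) → P → 𝟙 d ≡ 1
  𝟙-yes (yes _) _ = refl
  𝟙-yes (no ¬p) p = ⊥-elim (¬p p)

  𝟙-no : ∀ {P : Set} (d : Dec P) → ¬ P → 𝟙 d ≡ 0
  𝟙-no (yes p) ¬p = ⊥-elim (¬p p)
  𝟙-no (no _)  _  = refl

  data Shape : Set where
    empty : Shape
    mono  : Colour → Shape
    multi : Shape

  infixr 5 _◂_

  _◂_ : Colour → Shape → Shape
  c ◂ empty = mono c
  c ◂ mono d with c ≟ d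
  ... | yes _ = mono d
  ... | no  _ = multi
  c ◂ multi = multi

  shape : ∀ {n} → (Fin n → Colour) → Subset n → Shape
  shape col []            = empty
  shape col (outside ∷ A) = shape (col ∘ suc) A
  shape col (inside  ∷ A) = col zero ◂ shape (col ∘ suc) A

  rank₂ : Shape → ℕ
  rank₂ empty    = 0
  rank₂ (mono _) = 1
  rank₂ multi    = 2

  Fits : Shape → ℕ → Set
  Fits empty    s = s ≡ 0
  Fits (mono _) s = 1 ≤ s
  Fits multi    s = 2 ≤ s

  fits-◂ : ∀ c κ s → Fits κ s → Fits (c ◂ κ) (suc s)
  fits-◂ c empty    .0 refl = s≤s z≤n
  fits-◂ c (mono d) s  1≤s with c ≟ d
  ... | yes _ = s≤s z≤n
  ... | no  _ = s≤s 1≤s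
  fits-◂ c multi    s  2≤s = ℕ.m≤n⇒m≤1+n 2≤s

  shape-fits : ∀ {n} (col : Fin n → Colour) A → Fits (shape col A) ∣ A ∣
  shape-fits col []            = refl
  shape-fits col (outside ∷ A) = shape-fits (col ∘ suc) A
  shape-fits col (inside  ∷ A) = fits-◂ (col zero) _ _ (shape-fits (col ∘ suc) A)

  ShapeOf : ∀ {n} → (Fin n → Colour) → Subset n → Shape → Set
  ShapeOf col A empty    = Empty A
  ShapeOf col A (mono c) = (∀ {x} → x ∈ A → col x ≡ c) × Nonempty A
  ShapeOf col A multi    = ∃₂ λ x y → x ∈ A × y ∈ A × col x ≢ col y

  shape-view : ∀ {n} (col : Fin n → Colour) A → ShapeOf col A (shape col A)
  shape-view col []            (_ , ())
  shape-view col (outside ∷ A) = skip (shape (col ∘ suc) A) (shape-view (col ∘ suc) A)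
    where
    skip : ∀ κ → ShapeOf (col ∘ suc) A κ → ShapeOf col (outside ∷ A) κ
    skip empty    A-empty                      (suc x , there x∈)  = A-empty (x , x∈)
    skip (mono c) (all-c , x , x∈)             = (λ { (there x∈′) → all-c x∈′ }) , suc x , there x∈
    skip multi    (x , y , x∈ , y∈ , x≢y)     = suc x , suc y , there x∈ , there y∈ , x≢y
  shape-view col (inside ∷ A)  = add (shape (col ∘ suc) A) (shape-view (col ∘ suc) A)
    where
    add : ∀ κ → ShapeOf (col ∘ suc) A κ → ShapeOf col (inside ∷ A) (col zero ◂ κ)
    add empty    A-empty = (λ { here → refl ; (there x∈) → ⊥-elim (A-empty (_ , x∈)) }) , zero , here
    add (mono c) (all-c , x , x∈) with col zero ≟ c
    ... | yes c₀≡c = (λ { here → c₀≡c ; (there x∈′) → all-c x∈′ }) , zero , here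
    ... | no  c₀≢c = zero , suc x , here , there x∈ , λ c₀≡ → c₀≢c (trans c₀≡ (all-c x∈))
    add multi    (x , y , x∈ , y∈ , x≢y) = suc x , suc y , there x∈ , there y∈ , x≢y

  sumShapes : ∀ {n} → (Fin n → Colour) → (Shape → ℕ → ℤ) → ℤ
  sumShapes col g = sumSubsets (λ A → g (shape col A) ∣ A ∣)

  module _ {n : ℕ} where

    sumShapes-suc : ∀ (col : Fin (suc n) → Colour) g → sumShapes col g ≡
      sumShapes (col ∘ suc) g + sumShapes (col ∘ suc) (λ κ s → g (col zero ◂ κ) (suc s))
    sumShapes-suc col g = sumSubsets-suc {n} (λ A → g (shape col A) ∣ A ∣)

    sumShapes-cong : ∀ (col : Fin n → Colour) {g h : Shape → ℕ → ℤ} →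
      (∀ κ s → Fits κ s → g κ s ≡ h κ s) → sumShapes col g ≡ sumShapes col h
    sumShapes-cong col g≗h = sumSubsets-cong {n} (λ A → g≗h _ _ (shape-fits col A))

    sumShapes-scale : ∀ (col : Fin n → Colour) c {g h : Shape → ℕ → ℤ} →
      (∀ κ s → Fits κ s → g κ s ≡ c * h κ s) → sumShapes col g ≡ c * sumShapes col h
    sumShapes-scale col c {h = h} g≗ch =
      trans (sumShapes-cong col g≗ch) (sumSubsets-* {n} c (λ A → h (shape col A) ∣ A ∣))

  count : ∀ {n} → Colour → (Fin n → Colour) → ℕ
  count {zero}  c col = 0
  count {suc n} c col = 𝟙 (col zero ≟ c) ℕ.+ count c (col ∘ suc)

  prependIfZero : ℕ → Colour → List Colour → List Colour
  prependIfZero zero    c cs = c ∷ cs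
  prependIfZero (suc _) c cs = cs

  palette : ∀ {n} → (Fin n → Colour) → List Colour
  palette {zero}  col = []
  palette {suc n} col = prependIfZero (count (col zero) (col ∘ suc)) (col zero) (palette (col ∘ suc))

  classCount : ∀ {n} → (Fin n → Colour) → ℕ
  classCount col = length (palette col)

  tally : (ℕ → ℕ) → ∀ {n} → (Fin n → Colour) → ℕ
  tally Δ {zero}  col = 0
  tally Δ {suc n} col = tally Δ (col ∘ suc) ℕ.+ Δ (count (col zero) (col ∘ suc))

  -- Counting by first element: an element followed by a elements of its colour is the first
  -- element of 2^a nonempty monochromatic subsets and of a monochromatic pairs.
  monoSubsets : ∀ {n} → (Fin n → Colour) → ℕ
  monoSubsets = tally (2 ℕ.^_)

  monoPairs : ∀ {n} → (Fin n → Colour) → ℕ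
  monoPairs = tally id

  within : Colour → Shape → ℤ
  within c empty    = + 1
  within c (mono d) = + 𝟙 (d ≟ c)
  within c multi    = + 0

  isMono : Shape → ℤ
  isMono empty    = + 0
  isMono (mono _) = + 1
  isMono multi    = + 0

  within-◂ : ∀ c₀ c κ → within c (c₀ ◂ κ) ≡ + 𝟙 (c₀ ≟ c) * within c κ
  within-◂ c₀ c empty = sym (*-identityʳ _)
  within-◂ c₀ c (mono d) with c₀ ≟ d
  ... | yes refl with c₀ ≟ c
  ...   | yes _ = sym (*-identityˡ _)
  ...   | no  _ = refl
  within-◂ c₀ c (mono d) | no c₀≢d with c₀ ≟ c | d ≟ c
  ... | yes refl | yes refl = ⊥-elim (c₀≢d refl)
  ... | yes _    | no  _    = refl
  ... | no  _    | _        = refl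
  within-◂ c₀ c multi = sym (*-zeroʳ (+ 𝟙 (c₀ ≟ c)))

  isMono-◂ : ∀ c κ → isMono (c ◂ κ) ≡ within c κ
  isMono-◂ c empty = refl
  isMono-◂ c (mono d) with c ≟ d
  ... | yes refl = cong +_ (sym (𝟙-yes (c ≟ c) refl))
  ... | no  c≢d  = cong +_ (sym (𝟙-no (d ≟ c) (c≢d ∘ sym)))
  isMono-◂ c multi = refl

  module _ {n : ℕ} (col : Fin (suc n) → Colour) where

    private
      c₀   = col zero
      rest = col ∘ suc

    within-◂-scale : ∀ c (w : ℕ → ℤ) (z : ℤ) → (∀ s → w (suc s) ≡ z * w s) →
      ∀ κ s → within c (c₀ ◂ κ) * w (suc s) ≡ (+ 𝟙 (c₀ ≟ c) * z) * (within c κ * w s)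
    within-◂-scale c w z w-suc κ s = begin
      within c (c₀ ◂ κ) * w (suc s)              ≡⟨ cong₂ _*_ (within-◂ c₀ c κ) (w-suc s) ⟩
      (+ 𝟙 (c₀ ≟ c) * within c κ) * (z * w s)    ≡⟨ interchange (+ 𝟙 (c₀ ≟ c)) (within c κ) z (w s) ⟩
      (+ 𝟙 (c₀ ≟ c) * z) * (within c κ * w s)    ∎
      where
      open ≡-Reasoning
      interchange : ∀ d i z w → (d * i) * (z * w) ≡ (d * z) * (i * w)
      interchange = solve-∀

    sumShapes-isMono-suc : ∀ (w : ℕ → ℤ) → sumShapes col (λ κ s → isMono κ * w s) ≡
      sumShapes rest (λ κ s → isMono κ * w s) + sumShapes rest (λ κ s → within c₀ κ * w (suc s))
    sumShapes-isMono-suc w = trans (sumShapes-suc col (λ κ s → isMono κ * w s))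
      (cong (_+_ (sumShapes rest (λ κ s → isMono κ * w s)))
        (sumShapes-cong rest (λ κ s _ → cong (_* w (suc s)) (isMono-◂ c₀ κ))))

  sum-within-^ : ∀ {n} (col : Fin n → Colour) c z →
    sumShapes col (λ κ s → within c κ * z ^ s) ≡ (+ 1 + z) ^ count c col
  sum-within-^ {zero}  col c z = refl
  sum-within-^ {suc n} col c z = begin
    sumShapes col w
      ≡⟨ sumShapes-suc col w ⟩
    sumShapes (col ∘ suc) w + sumShapes (col ∘ suc) (λ κ s → within c (col zero ◂ κ) * z ^ suc s)
      ≡⟨ cong (_+_ (sumShapes (col ∘ suc) w))
           (sumShapes-scale (col ∘ suc) (+ 𝟙 (col zero ≟ c) * z)
             (λ κ s _ → within-◂-scale col c (z ^_) z (λ _ → refl) κ s)) ⟩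
    sumShapes (col ∘ suc) w + (+ 𝟙 (col zero ≟ c) * z) * sumShapes (col ∘ suc) w
      ≡⟨ cong (λ t → t + (+ 𝟙 (col zero ≟ c) * z) * t) (sum-within-^ (col ∘ suc) c z) ⟩
    p + (+ 𝟙 (col zero ≟ c) * z) * p
      ≡⟨ grow (col zero ≟ c) ⟩
    (+ 1 + z) ^ count c col
      ∎
    where
    open ≡-Reasoning
    w = λ κ s → within c κ * z ^ s
    p = (+ 1 + z) ^ count c (col ∘ suc)
    grow : (d : Dec (col zero ≡ c)) → p + (+ 𝟙 d * z) * p ≡ (+ 1 + z) ^ (𝟙 d ℕ.+ count c (col ∘ suc))
    grow (yes _) = factor p z
      where
      factor : ∀ p z → p + (+ 1 * z) * p ≡ (+ 1 + z) * p
      factor = solve-∀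
    grow (no _) = drop p z
      where
      drop : ∀ p z → p + (+ 0 * z) * p ≡ p
      drop = solve-∀

  sum-within-δ : ∀ {n} (col : Fin n → Colour) c k →
    sumShapes col (λ κ s → within c κ * δ k s) ≡ + (count c col C k)
  sum-within-δ {zero}  col c zero    = refl
  sum-within-δ {zero}  col c (suc k) = refl
  sum-within-δ {suc n} col c zero    = trans (sumShapes-suc col (λ κ s → within c κ * δ 0 s))
    (cong₂ _+_ (sum-within-δ (col ∘ suc) c 0)
               (sumShapes-scale (col ∘ suc) (+ 0) {h = λ _ _ → + 0} (λ κ s _ → *-zeroʳ (within c (col zero ◂ κ)))))
  sum-within-δ {suc n} col c (suc k) = begin
    sumShapes col (λ κ s → within c κ * δ (suc k) s)
      ≡⟨ sumShapes-suc col (λ κ s → within c κ * δ (suc k) s) ⟩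
    sumShapes (col ∘ suc) (λ κ s → within c κ * δ (suc k) s)
      + sumShapes (col ∘ suc) (λ κ s → within c (col zero ◂ κ) * δ k s)
      ≡⟨ cong₂ _+_ (sum-within-δ (col ∘ suc) c (suc k))
           (trans (sumShapes-scale (col ∘ suc) d (λ κ s _ → trans (cong (_* δ k s) (within-◂ (col zero) c κ))
                                                                  (*-assoc d (within c κ) (δ k s))))
                  (cong (d *_) (sum-within-δ (col ∘ suc) c k))) ⟩
    + (a C suc k) + d * + (a C k)
      ≡⟨ pascal (col zero ≟ c) ⟩
    + (count c col C suc k)
      ∎
    where
    open ≡-Reasoning
    a = count c (col ∘ suc)
    d = + 𝟙 (col zero ≟ c)
    pascal : (dec : Dec (col zero ≡ c)) → + (a C suc k) + + 𝟙 dec * + (a C k) ≡ + ((𝟙 dec ℕ.+ a) C suc k)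
    pascal (yes _) = trans (cong (_+_ (+ (a C suc k))) (*-identityˡ (+ (a C k))))
      (trans (+-comm (+ (a C suc k)) (+ (a C k))) (cong +_ (nCk+nC[k+1]≡[n+1]C[k+1] a k)))
    pascal (no _)  = +-identityʳ (+ (a C suc k))

  prependIfZero-length : ∀ a c cs →
    - + length cs + -[1+ 0 ] * (+ 0) ^ a ≡ - + length (prependIfZero a c cs)
  prependIfZero-length zero    c cs = shift (+ length cs)
    where
    shift : ∀ x → - x + -[1+ 0 ] * + 1 ≡ - (+ 1 + x)
    shift = solve-∀
  prependIfZero-length (suc a) c cs = keep (+ length cs) ((+ 0) ^ a)
    where
    keep : ∀ x y → - x + -[1+ 0 ] * (+ 0 * y) ≡ - x
    keep = solve-∀

  sum-isMono-1 : ∀ {n} (col : Fin n → Colour) → sumShapes col (λ κ s → isMono κ * (+ 1) ^ s) ≡ + monoSubsets col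
  sum-isMono-1 {zero}  col = refl
  sum-isMono-1 {suc n} col = begin
    sumShapes col (λ κ s → isMono κ * (+ 1) ^ s)
      ≡⟨ sumShapes-isMono-suc col ((+ 1) ^_) ⟩
    sumShapes (col ∘ suc) (λ κ s → isMono κ * (+ 1) ^ s)
      + sumShapes (col ∘ suc) (λ κ s → within (col zero) κ * (+ 1) ^ suc s)
      ≡⟨ cong₂ _+_ (sum-isMono-1 (col ∘ suc))
           (trans (sumShapes-cong (col ∘ suc) (λ κ s _ → cong (within (col zero) κ *_) (*-identityˡ ((+ 1) ^ s))))
                  (sum-within-^ (col ∘ suc) (col zero) (+ 1))) ⟩
    + monoSubsets (col ∘ suc) + (+ 2) ^ count (col zero) (col ∘ suc)
      ≡⟨ cong (_+_ (+ monoSubsets (col ∘ suc))) (pos-^ 2 (count (col zero) (col ∘ suc))) ⟨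
    + monoSubsets col
      ∎
    where open ≡-Reasoning

  sum-isMono-−1 : ∀ {n} (col : Fin n → Colour) → sumShapes col (λ κ s → isMono κ * -[1+ 0 ] ^ s) ≡ - + classCount col
  sum-isMono-−1 {zero}  col = refl
  sum-isMono-−1 {suc n} col = begin
    sumShapes col (λ κ s → isMono κ * -[1+ 0 ] ^ s)
      ≡⟨ sumShapes-isMono-suc col (-[1+ 0 ] ^_) ⟩
    sumShapes (col ∘ suc) (λ κ s → isMono κ * -[1+ 0 ] ^ s)
      + sumShapes (col ∘ suc) (λ κ s → within (col zero) κ * -[1+ 0 ] ^ suc s)
      ≡⟨ cong₂ _+_ (sum-isMono-−1 (col ∘ suc))
           (sumShapes-scale (col ∘ suc) -[1+ 0 ] (λ κ s _ → pull (within (col zero) κ) (-[1+ 0 ] ^ s))) ⟩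
    - + classCount (col ∘ suc) + -[1+ 0 ] * sumShapes (col ∘ suc) (λ κ s → within (col zero) κ * -[1+ 0 ] ^ s)
      ≡⟨ cong (λ t → - + classCount (col ∘ suc) + -[1+ 0 ] * t) (sum-within-^ (col ∘ suc) (col zero) -[1+ 0 ]) ⟩
    - + classCount (col ∘ suc) + -[1+ 0 ] * (+ 0) ^ count (col zero) (col ∘ suc)
      ≡⟨ prependIfZero-length (count (col zero) (col ∘ suc)) (col zero) (palette (col ∘ suc)) ⟩
    - + classCount col
      ∎
    where
    open ≡-Reasoning
    pull : ∀ i x → i * (-[1+ 0 ] * x) ≡ -[1+ 0 ] * (i * x)
    pull = solve-∀

  sum-isMono-δ₂ : ∀ {n} (col : Fin n → Colour) → sumShapes col (λ κ s → isMono κ * δ 2 s) ≡ + monoPairs col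
  sum-isMono-δ₂ {zero}  col = refl
  sum-isMono-δ₂ {suc n} col = begin
    sumShapes col (λ κ s → isMono κ * δ 2 s)
      ≡⟨ sumShapes-isMono-suc col (δ 2) ⟩
    sumShapes (col ∘ suc) (λ κ s → isMono κ * δ 2 s) + sumShapes (col ∘ suc) (λ κ s → within (col zero) κ * δ 1 s)
      ≡⟨ cong₂ _+_ (sum-isMono-δ₂ (col ∘ suc)) (sum-within-δ (col ∘ suc) (col zero) 1) ⟩
    + monoPairs (col ∘ suc) + + (count (col zero) (col ∘ suc) C 1)
      ≡⟨ cong (λ t → + (monoPairs (col ∘ suc) ℕ.+ t)) (nC1≡n (count (col zero) (col ∘ suc))) ⟩
    + monoPairs col
      ∎
    where open ≡-Reasoning

  -- rank2Sum col (x - 1) (y - 1) is the Tutte polynomial T(x, y) of the rank-2 matroid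
  -- whose parallel classes are the colour classes of col.
  rank2Term : ℤ → ℤ → Shape → ℕ → ℤ
  rank2Term p q κ s = p ^ (2 ∸ rank₂ κ) * q ^ (s ∸ rank₂ κ)

  rank2Sum : ∀ {n} → (Fin n → Colour) → ℤ → ℤ → ℤ
  rank2Sum col p q = sumShapes col (rank2Term p q)

  sumShapes-split : ∀ {n} (col : Fin n → Colour) (f : ℕ → ℤ) c →
    sumShapes col (λ κ s → f s + c * (isMono κ * f s)) ≡
    sumSubsets {n} (λ A → f ∣ A ∣) + c * sumShapes col (λ κ s → isMono κ * f s)
  sumShapes-split {n} col f c = trans (sumSubsets-+ {n} (λ A → f ∣ A ∣) (λ A → c * (isMono (shape col A) * f ∣ A ∣)))
    (cong (_+_ (sumSubsets {n} (λ A → f ∣ A ∣))) (sumSubsets-* {n} c (λ A → isMono (shape col A) * f ∣ A ∣)))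

  0^≡δ₀ : ∀ s → (+ 0) ^ s ≡ δ 0 s
  0^≡δ₀ zero    = refl
  0^≡δ₀ (suc s) = refl

  term[0,0] : ∀ κ s → Fits κ s → rank2Term (+ 0) (+ 0) κ s ≡ δ 2 s + -[1+ 0 ] * (isMono κ * δ 2 s)
  term[0,0] empty    .0                refl      = refl
  term[0,0] (mono d) (suc s)           _         = cancel ((+ 0) ^ s) (δ 1 s)
    where
    cancel : ∀ x y → (+ 0 * + 1) * x ≡ y + -[1+ 0 ] * (+ 1 * y)
    cancel = solve-∀
  term[0,0] multi    (suc zero)        (s≤s ())
  term[0,0] multi    (suc (suc s))     _         = trans (cong (+ 1 *_) (0^≡δ₀ s)) (keep (δ 0 s))
    where
    keep : ∀ y → + 1 * y ≡ y + -[1+ 0 ] * (+ 0 * y)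
    keep = solve-∀

  term[1,-1] : ∀ κ s → Fits κ s → rank2Term (+ 1) -[1+ 0 ] κ s ≡ -[1+ 0 ] ^ s + -[1+ 1 ] * (isMono κ * -[1+ 0 ] ^ s)
  term[1,-1] empty    .0            refl = refl
  term[1,-1] (mono d) (suc s)       _    = flip (-[1+ 0 ] ^ s)
    where
    flip : ∀ x → (+ 1 * + 1) * x ≡ -[1+ 0 ] * x + -[1+ 1 ] * (+ 1 * (-[1+ 0 ] * x))
    flip = solve-∀
  term[1,-1] multi    (suc zero)        (s≤s ())
  term[1,-1] multi    (suc (suc s)) _    = keep (-[1+ 0 ] ^ s)
    where
    keep : ∀ x → + 1 * x ≡ -[1+ 0 ] * (-[1+ 0 ] * x) + -[1+ 1 ] * (+ 0 * (-[1+ 0 ] * (-[1+ 0 ] * x)))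
    keep = solve-∀

  term[-1,1] : ∀ κ s → Fits κ s → rank2Term -[1+ 0 ] (+ 1) κ s ≡ (+ 1) ^ s + -[1+ 1 ] * (isMono κ * (+ 1) ^ s)
  term[-1,1] empty    .0            refl = refl
  term[-1,1] (mono d) (suc s)       _    = flip ((+ 1) ^ s)
    where
    flip : ∀ x → (-[1+ 0 ] * + 1) * x ≡ + 1 * x + -[1+ 1 ] * (+ 1 * (+ 1 * x))
    flip = solve-∀
  term[-1,1] multi    (suc zero)        (s≤s ())
  term[-1,1] multi    (suc (suc s)) _    = keep ((+ 1) ^ s)
    where
    keep : ∀ x → + 1 * x ≡ + 1 * (+ 1 * x) + -[1+ 1 ] * (+ 0 * (+ 1 * (+ 1 * x)))
    keep = solve-∀

  module _ {n : ℕ} (col : Fin n → Colour) where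

    rank2Sum[0,0] : rank2Sum col (+ 0) (+ 0) ≡ + (n C 2) + -[1+ 0 ] * + monoPairs col
    rank2Sum[0,0] = begin
      rank2Sum col (+ 0) (+ 0)
        ≡⟨ sumShapes-cong col term[0,0] ⟩
      sumShapes col (λ κ s → δ 2 s + -[1+ 0 ] * (isMono κ * δ 2 s))
        ≡⟨ sumShapes-split col (δ 2) -[1+ 0 ] ⟩
      sumSubsets {n} (λ A → δ 2 ∣ A ∣) + -[1+ 0 ] * sumShapes col (λ κ s → isMono κ * δ 2 s)
        ≡⟨ cong₂ (λ u v → u + -[1+ 0 ] * v) (sumSubsets-δ n 2) (sum-isMono-δ₂ col) ⟩
      + (n C 2) + -[1+ 0 ] * + monoPairs col
        ∎
      where open ≡-Reasoning

    rank2Sum[1,-1] : rank2Sum col (+ 1) -[1+ 0 ] ≡ (+ 0) ^ n + -[1+ 1 ] * - + classCount col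
    rank2Sum[1,-1] = begin
      rank2Sum col (+ 1) -[1+ 0 ]
        ≡⟨ sumShapes-cong col term[1,-1] ⟩
      sumShapes col (λ κ s → -[1+ 0 ] ^ s + -[1+ 1 ] * (isMono κ * -[1+ 0 ] ^ s))
        ≡⟨ sumShapes-split col (-[1+ 0 ] ^_) -[1+ 1 ] ⟩
      sumSubsets {n} (λ A → -[1+ 0 ] ^ ∣ A ∣) + -[1+ 1 ] * sumShapes col (λ κ s → isMono κ * -[1+ 0 ] ^ s)
        ≡⟨ cong₂ (λ u v → u + -[1+ 1 ] * v) (sumSubsets-^ n -[1+ 0 ]) (sum-isMono-−1 col) ⟩
      (+ 0) ^ n + -[1+ 1 ] * - + classCount col
        ∎
      where open ≡-Reasoning

    rank2Sum[-1,1] : rank2Sum col -[1+ 0 ] (+ 1) ≡ (+ 2) ^ n + -[1+ 1 ] * + monoSubsets col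
    rank2Sum[-1,1] = begin
      rank2Sum col -[1+ 0 ] (+ 1)
        ≡⟨ sumShapes-cong col term[-1,1] ⟩
      sumShapes col (λ κ s → (+ 1) ^ s + -[1+ 1 ] * (isMono κ * (+ 1) ^ s))
        ≡⟨ sumShapes-split col ((+ 1) ^_) -[1+ 1 ] ⟩
      sumSubsets {n} (λ A → (+ 1) ^ ∣ A ∣) + -[1+ 1 ] * sumShapes col (λ κ s → isMono κ * (+ 1) ^ s)
        ≡⟨ cong₂ (λ u v → u + -[1+ 1 ] * v) (sumSubsets-^ n (+ 1)) (sum-isMono-1 col) ⟩
      (+ 2) ^ n + -[1+ 1 ] * + monoSubsets col
        ∎
      where open ≡-Reasoning

  rank₂≤2 : ∀ κ → rank₂ κ ≤ 2
  rank₂≤2 empty    = z≤n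
  rank₂≤2 (mono _) = s≤s z≤n
  rank₂≤2 multi    = ℕ.≤-refl

  fits⇒rank₂≤ : ∀ {κ s} → Fits κ s → rank₂ κ ≤ s
  fits⇒rank₂≤ {empty}  _   = z≤n
  fits⇒rank₂≤ {mono _} 1≤s = 1≤s
  fits⇒rank₂≤ {multi}  2≤s = 2≤s

module PaletteBound {Colour : Set} (_≟_ : DecidableEquality Colour) where

  open import Data.Nat as ℕ using (ℕ; zero; suc; _≤_; s≤s; z≤n; _∸_)
  import Data.Nat.Properties as ℕ
  open import Data.Nat.Combinatorics using (_C_)
  open import Data.Nat.ListAction using (sum)
  open import Data.Integer using (ℤ; +_; -[1+_]; _+_; _*_; -_; _^_; +≤+)
  import Data.Integer as ℤ
  open import Data.Integer.Properties using (pos-*)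
  open import Data.Integer.Tactic.RingSolver using (solve-∀)
  import Data.Nat.Tactic.RingSolver as ℕ-Solver
  open import Data.Fin using (Fin; zero; suc)
  open import Data.List using (List; []; _∷_; length; map)
  open import Data.List.Properties using (map-∘; length-map)
  open import Data.List.Membership.Propositional using (_∈_)
  open import Data.List.Relation.Unary.Any using (here; there)
  open import Data.List.Relation.Unary.All using (All; []; _∷_; lookup; tabulate)
  open import Data.List.Relation.Unary.All.Properties using (map⁺)
  open import Data.List.Relation.Unary.Unique.Propositional using (Unique; []; _∷_)
  open import Data.Product using (∃; ∃₂; _×_; _,_)
  open import Data.Sum using (_⊎_; inj₁; inj₂)
  open import Function using (_∘_; id)
  open import Relation.Binary.PropositionalEquality
  open import Relation.Nullary using (yes; no; ¬_)
  open import Data.Empty using (⊥-elim)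

  open Arithmetic
  open SubsetSums
  open Colouring _≟_

  count-pos⇒∃ : ∀ {n} (col : Fin n → Colour) c → 1 ≤ count c col → ∃ λ e → col e ≡ c
  count-pos⇒∃ {suc n} col c 1≤count with col zero ≟ c
  ... | yes c₀≡c = zero , c₀≡c
  ... | no  _    with count-pos⇒∃ (col ∘ suc) c 1≤count
  ...   | e , eq = suc e , eq

  count-self : ∀ {n} (col : Fin n → Colour) e → 1 ≤ count (col e) col
  count-self col zero with col zero ≟ col zero
  ... | yes _ = s≤s z≤n
  ... | no ≢  = ⊥-elim (≢ refl)
  count-self col (suc e) = ℕ.≤-trans (count-self (col ∘ suc) e) (ℕ.m≤n+m _ _)

  count-pair : ∀ {n} (col : Fin n → Colour) {e f} c → e ≢ f → col e ≡ c → col f ≡ c → 2 ≤ count c col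
  count-pair col {zero}  {zero}  c e≢f _    _    = ⊥-elim (e≢f refl)
  count-pair col {zero}  {suc f} c _   refl f≡c with col zero ≟ col zero
  ... | yes _ = s≤s (subst (λ d → 1 ≤ count d (col ∘ suc)) f≡c (count-self (col ∘ suc) f))
  ... | no ≢  = ⊥-elim (≢ refl)
  count-pair col {suc e} {zero}  c _   e≡c refl with col zero ≟ col zero
  ... | yes _ = s≤s (subst (λ d → 1 ≤ count d (col ∘ suc)) e≡c (count-self (col ∘ suc) e))
  ... | no ≢  = ⊥-elim (≢ refl)
  count-pair col {suc e} {suc f} c e≢f e≡c f≡c =
    ℕ.≤-trans (count-pair (col ∘ suc) c (e≢f ∘ cong suc) e≡c f≡c) (ℕ.m≤n+m _ _)

  palette-count : ∀ {n} (col : Fin n → Colour) {c} → c ∈ palette col → 1 ≤ count c col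
  palette-count {suc n} col c∈ with count (col zero) (col ∘ suc)
  palette-count {suc n} col (here refl) | zero with col zero ≟ col zero
  ... | yes _ = s≤s z≤n
  ... | no ≢  = ⊥-elim (≢ refl)
  palette-count {suc n} col (there c∈) | zero  = ℕ.≤-trans (palette-count (col ∘ suc) c∈) (ℕ.m≤n+m _ _)
  palette-count {suc n} col c∈         | suc _ = ℕ.≤-trans (palette-count (col ∘ suc) c∈) (ℕ.m≤n+m _ _)

  palette-complete : ∀ {n} (col : Fin n → Colour) e → col e ∈ palette col
  palette-complete {suc n} col zero with count (col zero) (col ∘ suc) in eq
  ... | zero  = here refl
  ... | suc _ with count-pos⇒∃ (col ∘ suc) (col zero) (subst (1 ≤_) (sym eq) (s≤s z≤n))
  ...   | e , eq′ = subst (_∈ palette (col ∘ suc)) eq′ (palette-complete (col ∘ suc) e)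
  palette-complete {suc n} col (suc e) with count (col zero) (col ∘ suc)
  ... | zero  = there (palette-complete (col ∘ suc) e)
  ... | suc _ = palette-complete (col ∘ suc) e

  palette-unique : ∀ {n} (col : Fin n → Colour) → Unique (palette col)
  palette-unique {zero}  col = []
  palette-unique {suc n} col with count (col zero) (col ∘ suc) in eq
  ... | zero  = fresh (palette (col ∘ suc)) (λ c∈ → palette-count (col ∘ suc) c∈) ∷ palette-unique (col ∘ suc)
    where
    fresh : ∀ cs → (∀ {c} → c ∈ cs → 1 ≤ count c (col ∘ suc)) → All (col zero ≢_) cs
    fresh []       _   = []
    fresh (c ∷ cs) pos = (λ { refl → ℕ.<⇒≢ (pos (here refl)) (sym eq) }) ∷ fresh cs (pos ∘ there)
  ... | suc _ = palette-unique (col ∘ suc)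

  Complete : ∀ {n} → (Fin n → Colour) → List Colour → Set
  Complete col ds = ∀ e → col e ∈ ds

  sum-const : ∀ k (ds : List Colour) → sum (map (λ _ → k) ds) ≡ length ds ℕ.* k
  sum-const k []       = refl
  sum-const k (d ∷ ds) = cong (k ℕ.+_) (sum-const k ds)

  module _ {c₀ : Colour} (g h : Colour → ℕ) (h≗g : ∀ c → c₀ ≢ c → h c ≡ g c) where

    sum-unchanged : ∀ {ds} → All (c₀ ≢_) ds → sum (map h ds) ≡ sum (map g ds)
    sum-unchanged []           = refl
    sum-unchanged (c₀≢d ∷ c₀∉) = cong₂ ℕ._+_ (h≗g _ c₀≢d) (sum-unchanged c₀∉)

    sum-update : ∀ {ds} → c₀ ∈ ds → Unique ds → sum (map h ds) ℕ.+ g c₀ ≡ sum (map g ds) ℕ.+ h c₀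
    sum-update {_ ∷ ds} (here refl) (c₀∉ ∷ _) = begin
      h c₀ ℕ.+ sum (map h ds) ℕ.+ g c₀  ≡⟨ cong (λ t → h c₀ ℕ.+ t ℕ.+ g c₀) (sum-unchanged c₀∉) ⟩
      h c₀ ℕ.+ sum (map g ds) ℕ.+ g c₀  ≡⟨ rotate (h c₀) (sum (map g ds)) (g c₀) ⟩
      g c₀ ℕ.+ sum (map g ds) ℕ.+ h c₀  ∎
      where
      open ≡-Reasoning
      rotate : ∀ x y z → x ℕ.+ y ℕ.+ z ≡ z ℕ.+ y ℕ.+ x
      rotate = ℕ-Solver.solve-∀
    sum-update {d ∷ ds} (there c₀∈) (d∉ ∷ unique) = begin
      h d ℕ.+ sum (map h ds) ℕ.+ g c₀    ≡⟨ ℕ.+-assoc (h d) _ _ ⟩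
      h d ℕ.+ (sum (map h ds) ℕ.+ g c₀)  ≡⟨ cong₂ ℕ._+_ (h≗g d c₀≢d) (sum-update c₀∈ unique) ⟩
      g d ℕ.+ (sum (map g ds) ℕ.+ h c₀)  ≡⟨ ℕ.+-assoc (g d) _ _ ⟨
      g d ℕ.+ sum (map g ds) ℕ.+ h c₀    ∎
      where
      open ≡-Reasoning
      c₀≢d : c₀ ≢ d
      c₀≢d c₀≡d = lookup d∉ c₀∈ (sym c₀≡d)

  tally-sum : ∀ (f Δ : ℕ → ℕ) → (∀ a → f a ℕ.+ Δ a ≡ f (suc a)) →
    ∀ {n} (col : Fin n → Colour) ds → Complete col ds → Unique ds →
    tally Δ col ℕ.+ length ds ℕ.* f 0 ≡ sum (map (λ c → f (count c col)) ds)
  tally-sum f Δ step {zero}  col ds _        _      = sym (sum-const (f 0) ds)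
  tally-sum f Δ step {suc n} col ds complete unique = ℕ.+-cancelʳ-≡ (f a) _ _ (begin
    tally Δ rest ℕ.+ Δ a ℕ.+ L ℕ.+ f a    ≡⟨ regroup (tally Δ rest) (Δ a) L (f a) ⟩
    (tally Δ rest ℕ.+ L) ℕ.+ (f a ℕ.+ Δ a)
      ≡⟨ cong₂ ℕ._+_ (tally-sum f Δ step rest ds (complete ∘ suc) unique) (step a) ⟩
    sum (map g ds) ℕ.+ f (suc a)
      ≡⟨ cong (λ t → sum (map g ds) ℕ.+ f (t ℕ.+ a)) (𝟙-yes (col zero ≟ col zero) refl) ⟨
    sum (map g ds) ℕ.+ h (col zero)       ≡⟨ sum-update g h h≗g (complete zero) unique ⟨
    sum (map h ds) ℕ.+ f a                ∎)
    where
    open ≡-Reasoning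
    rest = col ∘ suc
    a = count (col zero) rest
    L = length ds ℕ.* f 0
    g h : Colour → ℕ
    g c = f (count c rest)
    h c = f (count c col)
    h≗g : ∀ c → col zero ≢ c → h c ≡ g c
    h≗g c ≢ = cong (λ t → f (t ℕ.+ count c rest)) (𝟙-no (col zero ≟ c) ≢)
    regroup : ∀ t d l x → t ℕ.+ d ℕ.+ l ℕ.+ x ≡ (t ℕ.+ l) ℕ.+ (x ℕ.+ d)
    regroup = ℕ-Solver.solve-∀

  module _ {n} (col : Fin n → Colour) (ds : List Colour) (complete : Complete col ds) (unique : Unique ds) where

    size-sum : n ≡ sum (map (λ c → count c col) ds)
    size-sum = trans (tally-1 col) (trans (sym (ℕ.+-identityʳ _)) (trans (cong (tally (λ _ → 1) col ℕ.+_) (sym (ℕ.*-zeroʳ (length ds))))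
      (tally-sum id (λ _ → 1) (λ a → ℕ.+-comm a 1) col ds complete unique)))
      where
      tally-1 : ∀ {m} (col : Fin m → Colour) → m ≡ tally (λ _ → 1) col
      tally-1 {zero}  col = refl
      tally-1 {suc m} col = trans (cong suc (tally-1 (col ∘ suc))) (ℕ.+-comm 1 _)

    monoSubsets-sum : monoSubsets col ℕ.+ length ds ≡ sum (map (λ c → 2 ℕ.^ count c col) ds)
    monoSubsets-sum = trans (cong (monoSubsets col ℕ.+_) (sym (ℕ.*-identityʳ (length ds))))
      (tally-sum (2 ℕ.^_) (2 ℕ.^_) (λ a → cong (2 ℕ.^ a ℕ.+_) (sym (ℕ.+-identityʳ (2 ℕ.^ a)))) col ds complete unique)

    monoPairs-sum : monoPairs col ≡ sum (map (λ c → count c col C 2) ds)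
    monoPairs-sum = trans (sym (ℕ.+-identityʳ _)) (trans (cong (monoPairs col ℕ.+_) (sym (ℕ.*-zeroʳ (length ds))))
      (tally-sum (_C 2) id (λ a → sym ([1+n]C2≡nC2+n a)) col ds complete unique))

  StaysMulticoloured : ∀ {n} → (Fin n → Colour) → Set
  StaysMulticoloured {n} col = ∀ (e : Fin n) → ∃₂ λ f g → f ≢ e × g ≢ e × col f ≢ col g

  distinct-members⇒2≤length : ∀ {x y} {ds : List Colour} → x ∈ ds → y ∈ ds → x ≢ y → 2 ≤ length ds
  distinct-members⇒2≤length (here refl) (here refl) x≢y = ⊥-elim (x≢y refl)
  distinct-members⇒2≤length {ds = _ ∷ _ ∷ _} _ _ _ = s≤s (s≤s z≤n)

  pair-cover : ∀ {x y c u v : Colour} → c ∈ x ∷ y ∷ [] → u ∈ x ∷ y ∷ [] → v ∈ x ∷ y ∷ [] → u ≢ v → u ≡ c ⊎ v ≡ c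
  pair-cover (here refl)         (here refl)         _                   _   = inj₁ refl
  pair-cover (there (here refl)) (there (here refl)) _                   _   = inj₁ refl
  pair-cover _                   (here refl)         (here refl)         u≢v = ⊥-elim (u≢v refl)
  pair-cover _                   (there (here refl)) (there (here refl)) u≢v = ⊥-elim (u≢v refl)
  pair-cover (here refl)         (there (here refl)) (here refl)         _   = inj₂ refl
  pair-cover (there (here refl)) (here refl)         (there (here refl)) _   = inj₂ refl

  two-classes-large : ∀ {n} (col : Fin n → Colour) → StaysMulticoloured col → ∀ {x y} →
    Complete col (x ∷ y ∷ []) → ∀ {c} → c ∈ x ∷ y ∷ [] → 1 ≤ count c col → 2 ≤ count c col
  two-classes-large col stays complete c∈ 1≤count with count-pos⇒∃ col _ 1≤count
  ... | e , e≡c with stays e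
  ...   | f , g , f≢e , g≢e , f≢g with pair-cover c∈ (complete f) (complete g) f≢g
  ...     | inj₁ f≡c = count-pair col _ (f≢e ∘ sym) e≡c f≡c
  ...     | inj₂ g≡c = count-pair col _ (g≢e ∘ sym) e≡c g≡c

  square-bound⇒rank2Sum-bound : ∀ {n} (col : Fin (suc n) → Colour) →
    SquareBound (suc n) (monoPairs col) (monoSubsets col) (2 ℕ.* classCount col) →
    rank2Sum col (+ 0) (+ 0) * rank2Sum col (+ 0) (+ 0) ℤ.≤ rank2Sum col (+ 1) -[1+ 0 ] * rank2Sum col -[1+ 0 ] (+ 1)
  square-bound⇒rank2Sum-bound {n} col (m , y , P+m≡ , 2Q+y≡ , m²≤xy) = subst₂ ℤ._≤_
    (sym (cong₂ _*_ [0,0]≡m [0,0]≡m)) (sym (cong₂ _*_ [1,-1]≡x [-1,1]≡y))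
    (subst₂ ℤ._≤_ (pos-* m m) (pos-* (2 ℕ.* classCount col) y) (+≤+ m²≤xy))
    where
    [0,0]≡m : rank2Sum col (+ 0) (+ 0) ≡ + m
    [0,0]≡m = trans (rank2Sum[0,0] col) (trans (cong (λ t → + t + -[1+ 0 ] * + monoPairs col) (sym P+m≡))
                (cancel (+ monoPairs col) (+ m)))
      where
      cancel : ∀ p m → (p + m) + -[1+ 0 ] * p ≡ m
      cancel = solve-∀
    [1,-1]≡x : rank2Sum col (+ 1) -[1+ 0 ] ≡ + (2 ℕ.* classCount col)
    [1,-1]≡x = trans (rank2Sum[1,-1] col) (trans (double (+ classCount col)) (sym (pos-* 2 (classCount col))))
      where
      double : ∀ k → + 0 + -[1+ 1 ] * - k ≡ + 2 * k
      double = solve-∀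
    [-1,1]≡y : rank2Sum col -[1+ 0 ] (+ 1) ≡ + y
    [-1,1]≡y = begin
      rank2Sum col -[1+ 0 ] (+ 1)                              ≡⟨ rank2Sum[-1,1] col ⟩
      (+ 2) ^ suc n + -[1+ 1 ] * + Q                           ≡⟨ cong (_+ -[1+ 1 ] * + Q) (pos-^ 2 (suc n)) ⟨
      + (2 ℕ.^ suc n) + -[1+ 1 ] * + Q                         ≡⟨ cong (λ t → + t + -[1+ 1 ] * + Q) 2Q+y≡ ⟨
      + (2 ℕ.* Q) + + y + -[1+ 1 ] * + Q                       ≡⟨ cong (λ t → t + + y + -[1+ 1 ] * + Q) (pos-* 2 Q) ⟩
      + 2 * + Q + + y + -[1+ 1 ] * + Q                         ≡⟨ cancel (+ Q) (+ y) ⟩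
      + y                                                      ∎
      where
      open ≡-Reasoning
      Q = monoSubsets col
      cancel : ∀ q y → (+ 2 * q + y) + -[1+ 1 ] * q ≡ y
      cancel = solve-∀

  rank2Sum-bound : ∀ {n} (col : Fin n → Colour) → StaysMulticoloured col →
    rank2Sum col (+ 0) (+ 0) * rank2Sum col (+ 0) (+ 0) ℤ.≤ rank2Sum col (+ 1) -[1+ 0 ] * rank2Sum col -[1+ 0 ] (+ 1)
  rank2Sum-bound {zero}  col _     = +≤+ z≤n
  rank2Sum-bound {suc n} col stays = square-bound⇒rank2Sum-bound col
    (class-sizes-bound sizes (map⁺ (tabulate (palette-count col))) two-classes⇒large more-than-one
      (size-sum col ds complete unique)
      (trans (monoPairs-sum col ds complete unique) (cong sum (map-∘ ds)))
      (trans (cong (monoSubsets col ℕ.+_) (length-map _ ds)) (trans (monoSubsets-sum col ds complete unique) (cong sum (map-∘ ds))))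
      (ℕ.≤-reflexive (cong (2 ℕ.*_) (length-map _ ds))))
    where
    ds = palette col
    complete = palette-complete col
    unique = palette-unique col
    sizes = map (λ c → count c col) ds
    more-than-one : 2 ≤ length sizes
    more-than-one with stays zero
    ... | f , g , _ , _ , f≢g =
      subst (2 ≤_) (sym (length-map _ ds)) (distinct-members⇒2≤length (complete f) (complete g) f≢g)
    large-if-two : ∀ cs → Complete col cs → (∀ {c} → c ∈ cs → 1 ≤ count c col) → length cs ≡ 2 →
      All (λ c → 2 ≤ count c col) cs
    large-if-two (x ∷ y ∷ []) complete′ pos refl =
      two-classes-large col stays complete′ (here refl) (pos (here refl)) ∷
      two-classes-large col stays complete′ (there (here refl)) (pos (there (here refl))) ∷ []
    two-classes⇒large : length sizes ≡ 2 → All (2 ≤_) sizes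
    two-classes⇒large len = map⁺ (large-if-two ds complete (palette-count col) (trans (sym (length-map _ ds)) len))

module FiniteSubsets where

  open import Data.Nat using (zero; suc; _≤_; _<_; s≤s; s≤s⁻¹; z≤n; _+_)
  open import Data.Nat.Properties hiding (_≟_)
  open import Data.Fin using (Fin; zero; suc; _≟_)
  open import Data.Fin.Subset
  open import Data.Fin.Subset.Properties
  open import Data.Vec using (_∷_; here; there)
  open import Data.Product using (∃; ∃₂; _×_; _,_)
  open import Data.Sum using (_⊎_; inj₁; inj₂; [_,_]′)
  open import Function using (_∘_)
  open import Relation.Binary.PropositionalEquality
  open import Relation.Nullary using (yes; no; ¬_)
  open import Data.Empty using (⊥-elim)

  x∉p-x : ∀ {n} (x : Fin n) p → x ∉ p - x
  x∉p-x zero    (s ∷ p) ()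
  x∉p-x (suc x) (s ∷ p) (there x∈) = x∉p-x x p x∈

  x∈p-y⇒x≢y : ∀ {n} {x y : Fin n} {p} → x ∈ p - y → x ≢ y
  x∈p-y⇒x≢y {x = x} {p = p} x∈ refl = x∉p-x x p x∈

  x∈p-y⇒x∈p : ∀ {n} {x y : Fin n} {p} → x ∈ p - y → x ∈ p
  x∈p-y⇒x∈p {y = y} {p = p} = p─q⊆p p ⁅ y ⁆

  ∣p∣≡1+∣p-x∣ : ∀ {n} {x : Fin n} {p} → x ∈ p → ∣ p ∣ ≡ suc ∣ p - x ∣
  ∣p∣≡1+∣p-x∣ {x = zero}  {inside ∷ p}  here       = cong (suc ∘ ∣_∣) (sym (p─⊥≡p p))
  ∣p∣≡1+∣p-x∣ {x = suc x} {inside ∷ p}  (there x∈) = cong suc (∣p∣≡1+∣p-x∣ x∈)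
  ∣p∣≡1+∣p-x∣ {x = suc x} {outside ∷ p} (there x∈) = ∣p∣≡1+∣p-x∣ x∈

  x∈p⇒1≤∣p∣ : ∀ {n} {x : Fin n} {p} → x ∈ p → 1 ≤ ∣ p ∣
  x∈p⇒1≤∣p∣ x∈ = ≤-trans (s≤s z≤n) (x∈p⇒∣p-x∣<∣p∣ x∈)

  x,y∈p⇒2≤∣p∣ : ∀ {n} {x y : Fin n} {p} → x ∈ p → y ∈ p → x ≢ y → 2 ≤ ∣ p ∣
  x,y∈p⇒2≤∣p∣ x∈ y∈ x≢y = ≤-trans (s≤s (x∈p⇒1≤∣p∣ (x∈p∧x≢y⇒x∈p-y y∈ (x≢y ∘ sym)))) (x∈p⇒∣p-x∣<∣p∣ x∈)

  Empty⇒∣p∣≡0 : ∀ {n} {p : Subset n} → Empty p → ∣ p ∣ ≡ 0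
  Empty⇒∣p∣≡0 {n} empty = trans (cong ∣_∣ (Empty-unique empty)) (∣⊥∣≡0 n)

  1≤∣p∣⇒Nonempty : ∀ {n} {p : Subset n} → 1 ≤ ∣ p ∣ → Nonempty p
  1≤∣p∣⇒Nonempty {p = p} 1≤∣p∣ with nonempty? p
  ... | yes nonempty = nonempty
  ... | no  empty    = ⊥-elim (<⇒≢ 1≤∣p∣ (sym (Empty⇒∣p∣≡0 empty)))

  2≤∣p∣⇒distinct : ∀ {n} {p : Subset n} → 2 ≤ ∣ p ∣ → ∃₂ λ x y → x ∈ p × y ∈ p × x ≢ y
  2≤∣p∣⇒distinct {p = p} 2≤∣p∣ with 1≤∣p∣⇒Nonempty (≤-trans (s≤s z≤n) 2≤∣p∣)
  ... | x , x∈ with 1≤∣p∣⇒Nonempty {p = p - x} (s≤s⁻¹ (subst (2 ≤_) (∣p∣≡1+∣p-x∣ x∈) 2≤∣p∣))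
  ...   | y , y∈ = x , y , x∈ , x∈p-y⇒x∈p y∈ , x∈p-y⇒x≢y y∈ ∘ sym

  ⊆∧∣∣≤⇒⊇ : ∀ {n} {p q : Subset n} → p ⊆ q → ∣ q ∣ ≤ ∣ p ∣ → q ⊆ p
  ⊆∧∣∣≤⇒⊇ {p = p} {q} p⊆q ∣q∣≤∣p∣ {x} x∈q with x ∈? p
  ... | yes x∈p = x∈p
  ... | no  x∉p = ⊥-elim (<⇒≱ (≤-trans (s≤s (p⊆q⇒∣p∣≤∣q∣ p⊆q-x)) (x∈p⇒∣p-x∣<∣p∣ x∈q)) ∣q∣≤∣p∣)
    where
    p⊆q-x : p ⊆ q - x
    p⊆q-x {z} z∈p = x∈p∧x≢y⇒x∈p-y (p⊆q z∈p) (λ { refl → x∉p z∈p })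

  ∣∁p∣+∣p∣≡n : ∀ {n} (p : Subset n) → ∣ ∁ p ∣ + ∣ p ∣ ≡ n
  ∣∁p∣+∣p∣≡n p = trans (cong (_+ ∣ p ∣) (∣∁p∣≡n∸∣p∣ p)) (m∸n+n≡m (∣p∣≤n p))

  ∁-antitone : ∀ {n} {p q : Subset n} → p ⊆ q → ∁ q ⊆ ∁ p
  ∁-antitone p⊆q x∈∁q = x∉p⇒x∈∁p (x∈∁p⇒x∉p x∈∁q ∘ p⊆q)

  pair : ∀ {n} → Fin n → Fin n → Subset n
  pair x y = ⁅ x ⁆ ∪ ⁅ y ⁆

  module _ {n} {x y : Fin n} where

    x∈pair : x ∈ pair x y
    x∈pair = x∈p∪q⁺ (inj₁ (x∈⁅x⁆ x))

    y∈pair : y ∈ pair x y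
    y∈pair = x∈p∪q⁺ (inj₂ (x∈⁅x⁆ y))

    ∈pair⁻ : ∀ {z} → z ∈ pair x y → z ≡ x ⊎ z ≡ y
    ∈pair⁻ z∈ with x∈p∪q⁻ ⁅ x ⁆ ⁅ y ⁆ z∈
    ... | inj₁ z∈x = inj₁ (x∈⁅y⁆⇒x≡y x z∈x)
    ... | inj₂ z∈y = inj₂ (x∈⁅y⁆⇒x≡y y z∈y)

    pair⊆ : ∀ {B} → x ∈ B → y ∈ B → pair x y ⊆ B
    pair⊆ x∈ y∈ z∈ with ∈pair⁻ z∈
    ... | inj₁ refl = x∈
    ... | inj₂ refl = y∈

    ∉∁pair : ∀ {z} → z ∈ ∁ (pair x y) → z ≢ x × z ≢ y
    ∉∁pair z∈ = (λ { refl → x∈∁p⇒x∉p z∈ x∈pair }) , (λ { refl → x∈∁p⇒x∉p z∈ y∈pair })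

    ∈∁pair : ∀ {z} → z ≢ x → z ≢ y → z ∈ ∁ (pair x y)
    ∈∁pair z≢x z≢y = x∉p⇒x∈∁p ([ z≢x , z≢y ]′ ∘ ∈pair⁻)

    ∣pair∣≡2 : x ≢ y → ∣ pair x y ∣ ≡ 2
    ∣pair∣≡2 x≢y = begin
      ∣ pair x y ∣              ≡⟨ ∣p∣≡1+∣p-x∣ x∈pair ⟩
      suc ∣ pair x y - x ∣      ≡⟨ cong suc (∣p∣≡1+∣p-x∣ (x∈p∧x≢y⇒x∈p-y y∈pair (x≢y ∘ sym))) ⟩
      2 + ∣ pair x y - x - y ∣  ≡⟨ cong (2 +_) (Empty⇒∣p∣≡0 nothing-left) ⟩
      2                         ∎
      where
      open ≡-Reasoning
      nothing-left : Empty (pair x y - x - y)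
      nothing-left (z , z∈) with ∈pair⁻ (x∈p-y⇒x∈p (x∈p-y⇒x∈p z∈))
      ... | inj₁ z≡x = x∈p-y⇒x≢y (x∈p-y⇒x∈p z∈) z≡x
      ... | inj₂ z≡y = x∈p-y⇒x≢y z∈ z≡y

  pair-comm : ∀ {n} {x y : Fin n} → pair x y ⊆ pair y x
  pair-comm = pair⊆ y∈pair x∈pair

  ∣p∣≡2⇒pair : ∀ {n} {p : Subset n} {e} → ∣ p ∣ ≡ 2 → e ∈ p →
    ∃ λ h → h ≢ e × h ∈ p × (∀ {z} → z ∈ p → z ≡ e ⊎ z ≡ h)
  ∣p∣≡2⇒pair {p = p} {e} ∣p∣≡2 e∈
    with 1≤∣p∣⇒Nonempty {p = p - e} (s≤s⁻¹ (subst (2 ≤_) (trans (sym ∣p∣≡2) (∣p∣≡1+∣p-x∣ e∈)) ≤-refl))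
  ... | h , h∈ = h , x∈p-y⇒x≢y h∈ , x∈p-y⇒x∈p h∈ , only
    where
    only : ∀ {z} → z ∈ p → z ≡ e ⊎ z ≡ h
    only {z} z∈ with z ≟ e | z ≟ h
    ... | yes z≡e | _       = inj₁ z≡e
    ... | no  _   | yes z≡h = inj₂ z≡h
    ... | no  z≢e | no  z≢h = ⊥-elim (<⇒≱ three (≤-reflexive ∣p∣≡2))
      where
      three : 2 < ∣ p ∣
      three = subst (2 <_) (sym (∣p∣≡1+∣p-x∣ e∈))
        (s≤s (x,y∈p⇒2≤∣p∣ h∈ (x∈p∧x≢y⇒x∈p-y z∈ z≢e) (λ h≡z → z≢h (sym h≡z))))

module MatroidRank where

  open import Data.Nat using (ℕ; zero; suc; _≤_; _<_; _+_; _⊔_)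
  open import Data.Nat.Properties hiding (_≟_)
  open import Data.Fin using (zero; suc)
  open import Data.Fin.Subset using (Subset; inside; outside; ∣_∣; _∈_; _∉_; _⊆_; _⊂_; ⁅_⁆; _∪_; ⊤; ⊥)
  open import Data.Fin.Subset.Properties
    using (_⊆?_; _∈?_; ⊆⊤; ⊥⊆; ∣⊥∣≡0; ∣⊤∣≡n; p⊆q⇒∣p∣≤∣q∣; x∈⁅x⁆; x∈p∪q⁺; q⊆p∪q; p⊂q⇒∣p∣<∣q∣)
  open import Data.Vec using ([]; _∷_)
  open import Data.List using ([]; _∷_; map; _++_; foldr)
  open import Data.List.Membership.Propositional using () renaming (_∈_ to _∈ₗ_)
  open import Data.List.Membership.Propositional.Properties using (∈-++⁺ˡ; ∈-++⁺ʳ; ∈-map⁺)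
  open import Data.List.Relation.Unary.Any using (here; there)
  open import Data.Product using (∃; _×_; _,_; proj₁; proj₂)
  open import Data.Sum using (_⊎_; inj₁; inj₂)
  open import Relation.Binary.PropositionalEquality
  open import Relation.Nullary using (yes; no; ¬_)
  open import Data.Empty using (⊥-elim)
  open import Function using (_∘_; id)
  open FiniteSubsets

  module FoldMax {A : Set} (size : A → ℕ) (Good : A → Set) (step : A → ℕ → ℕ)
    (step-view : ∀ x m → (¬ Good x × step x m ≡ m) ⊎ (Good x × step x m ≡ size x ⊔ m)) where

    step-≥ : ∀ x m → m ≤ step x m
    step-≥ x m with step-view x m
    ... | inj₁ (_ , eq) = ≤-reflexive (sym eq)
    ... | inj₂ (_ , eq) = subst (m ≤_) (sym eq) (m≤n⊔m (size x) m)

    foldr-≥ : ∀ {x} xs → x ∈ₗ xs → Good x → size x ≤ foldr step 0 xs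
    foldr-≥ (x ∷ xs) (here refl) good with step-view x (foldr step 0 xs)
    ... | inj₁ (bad , _) = ⊥-elim (bad good)
    ... | inj₂ (_ , eq)  = subst (size x ≤_) (sym eq) (m≤m⊔n (size x) _)
    foldr-≥ (y ∷ xs) (there x∈) good = ≤-trans (foldr-≥ xs x∈ good) (step-≥ y _)

    foldr-attained : ∀ {x₀} → Good x₀ → size x₀ ≡ 0 → ∀ xs → ∃ λ w → Good w × foldr step 0 xs ≡ size w
    foldr-attained {x₀} good₀ size₀ [] = x₀ , good₀ , sym size₀
    foldr-attained good₀ size₀ (x ∷ xs) with foldr-attained good₀ size₀ xs | step-view x (foldr step 0 xs)
    ... | w , good , eq | inj₁ (_ , eq′) = w , good , trans eq′ eq
    ... | w , good , eq | inj₂ (goodx , eq′) with ≤-total (size x) (foldr step 0 xs)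
    ...   | inj₁ ≤ = w , good , trans eq′ (trans (m≤n⇒m⊔n≡n ≤) eq)
    ...   | inj₂ ≥ = x , goodx , trans eq′ (m≥n⇒m⊔n≡m ≥)

  allSubsets-complete : ∀ n (B : Subset n) → B ∈ₗ allSubsets n
  allSubsets-complete zero    [] = here refl
  allSubsets-complete (suc n) (outside ∷ B) = ∈-++⁺ˡ (∈-map⁺ (outside ∷_) (allSubsets-complete n B))
  allSubsets-complete (suc n) (inside ∷ B)  =
    ∈-++⁺ʳ (map (outside ∷_) (allSubsets n)) (∈-map⁺ (inside ∷_) (allSubsets-complete n B))

  module _ {n : ℕ} (M : Matroid n) where

    open Matroid M

    -- The step function folded by rankOf is local to Defs and cannot be named here:
    -- the underscores in the type of rank-step-view are solved by unification in rankOf-spec.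
    mutual
      rankOf-spec : ∀ A → (∀ B → B ⊆ A → Indep B → ∣ B ∣ ≤ rankOf M A) ×
                          (∃ λ W → (W ⊆ A × Indep W) × rankOf M A ≡ ∣ W ∣)
      rankOf-spec A =
        (λ B B⊆A indep → FoldMax.foldr-≥ ∣_∣ _ _ (rank-step-view A) (allSubsets n) (allSubsets-complete n B) (B⊆A , indep)) ,
        FoldMax.foldr-attained ∣_∣ _ _ (rank-step-view A) (⊥⊆ , indep-empty) (∣⊥∣≡0 n) (allSubsets n)

      rank-step-view : ∀ A B m → (¬ (B ⊆ A × Indep B) × _ ≡ m) ⊎ ((B ⊆ A × Indep B) × _ ≡ ∣ B ∣ ⊔ m)
      rank-step-view A B m with B ⊆? A | Indep? B
      ... | yes B⊆A | yes indep = inj₂ ((B⊆A , indep) , refl)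
      ... | yes _   | no ¬indep = inj₁ ((¬indep ∘ proj₂) , refl)
      ... | no ¬B⊆A | _         = inj₁ ((¬B⊆A ∘ proj₁) , refl)

    rank-≥ : ∀ A B → B ⊆ A → Indep B → ∣ B ∣ ≤ rankOf M A
    rank-≥ A = proj₁ (rankOf-spec A)

    rank-attained : ∀ A → ∃ λ W → (W ⊆ A × Indep W) × rankOf M A ≡ ∣ W ∣
    rank-attained A = proj₂ (rankOf-spec A)

    rank-≤ : ∀ A {t} → (∀ B → B ⊆ A → Indep B → ∣ B ∣ ≤ t) → rankOf M A ≤ t
    rank-≤ A bound with rank-attained A
    ... | W , (W⊆A , indep) , eq = subst (_≤ _) (sym eq) (bound W W⊆A indep)

    indep⇒≤rank : ∀ {B} → Indep B → ∣ B ∣ ≤ rank M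
    indep⇒≤rank indep = rank-≥ ⊤ _ ⊆⊤ indep

    rankOf≤∣∣ : ∀ A → rankOf M A ≤ ∣ A ∣
    rankOf≤∣∣ A = rank-≤ A (λ B B⊆A _ → p⊆q⇒∣p∣≤∣q∣ B⊆A)

    rankOf≤rank : ∀ A → rankOf M A ≤ rank M
    rankOf≤rank A = rank-≤ A (λ _ _ → indep⇒≤rank)

    rank≤n : rank M ≤ n
    rank≤n = subst (rank M ≤_) (∣⊤∣≡n n) (rankOf≤∣∣ ⊤)

    dependent⇒rankOf<∣∣ : ∀ {A} → ¬ Indep A → rankOf M A < ∣ A ∣
    dependent⇒rankOf<∣∣ {A} ¬indep with rank-attained A
    ... | W , (W⊆A , indepW) , eq with ∣ W ∣ <? ∣ A ∣
    ...   | yes below = subst (_< ∣ A ∣) (sym eq) below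
    ...   | no ¬below = ⊥-elim (¬indep (indep-hered W A (⊆∧∣∣≤⇒⊇ W⊆A (≮⇒≥ ¬below)) indepW))

    augment-below-rank : ∀ {I} → Indep I → ∣ I ∣ < rank M → ∃ λ e → e ∉ I × Indep (⁅ e ⁆ ∪ I)
    augment-below-rank {I} indep <rank with rank-attained ⊤
    ... | W , (_ , indepW) , eq with indep-augment I W indep indepW (subst (∣ I ∣ <_) eq <rank)
    ...   | e , _ , e∉I , indep′ = e , e∉I , indep′

    basis-size : ∀ {B} → IsBasis M B → ∣ B ∣ ≡ rank M
    basis-size {B} (indep , maximal) = ≤-antisym (indep⇒≤rank indep) (≮⇒≥ not-below)
      where
      not-below : ¬ ∣ B ∣ < rank M
      not-below <rank with augment-below-rank indep <rank
      ... | e , e∉B , indep′ = e∉B (subst (e ∈_) (maximal _ (q⊆p∪q ⁅ e ⁆ B) indep′) (x∈p∪q⁺ (inj₁ (x∈⁅x⁆ e))))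

    extend-to-rank : ∀ {I} → Indep I → ∃ λ J → I ⊆ J × Indep J × ∣ J ∣ ≡ rank M
    extend-to-rank {I} indep = grow (rank M) I indep (m≤m+n (rank M) ∣ I ∣) id
      where
      grow : ∀ k J → Indep J → rank M ≤ k + ∣ J ∣ → I ⊆ J → ∃ λ J′ → I ⊆ J′ × Indep J′ × ∣ J′ ∣ ≡ rank M
      grow k J indepJ bound I⊆J with ∣ J ∣ <? rank M
      ... | no  ¬below = J , I⊆J , indepJ , ≤-antisym (indep⇒≤rank indepJ) (≮⇒≥ ¬below)
      grow zero    J indepJ bound I⊆J | yes below = ⊥-elim (<⇒≱ below bound)
      grow (suc k) J indepJ bound I⊆J | yes below with augment-below-rank indepJ below
      ... | e , e∉J , indep′ = grow k (⁅ e ⁆ ∪ J) indep′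
            (≤-trans bound (subst (_≤ k + ∣ ⁅ e ⁆ ∪ J ∣) (+-suc k ∣ J ∣) (+-monoʳ-≤ k (p⊂q⇒∣p∣<∣q∣ J⊂))))
            (q⊆p∪q ⁅ e ⁆ J ∘ I⊆J)
        where
        J⊂ : J ⊂ ⁅ e ⁆ ∪ J
        J⊂ = q⊆p∪q ⁅ e ⁆ J , e , x∈p∪q⁺ (inj₁ (x∈⁅x⁆ e)) , e∉J

    nonloop⇒indep : ∀ {e} → ¬ IsLoop M e → Indep ⁅ e ⁆
    nonloop⇒indep {e} nonloop with Indep? ⁅ e ⁆
    ... | yes indep = indep
    ... | no ¬indep = ⊥-elim (nonloop ¬indep)

    noncoloop⇒¬¬avoiding-basis : ∀ {e} → ¬ IsColoop M e → ¬ ¬ (∃ λ B → IsBasis M B × e ∉ B)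
    noncoloop⇒¬¬avoiding-basis {e} noncoloop no-avoiding = noncoloop in-every-basis
      where
      in-every-basis : ∀ B → IsBasis M B → e ∈ B
      in-every-basis B basis with e ∈? B
      ... | yes e∈B = e∈B
      ... | no  e∉B = ⊥-elim (no-avoiding (B , basis , e∉B))

module ClassColouring {n : ℕ} {Same : Fin n → Fin n → Set} (same? : Decidable Same)
  (equivalence : IsEquivalence Same) where

  open import Data.Nat using (ℕ; zero; suc)
  open import Data.Bool using (Bool; true; false)
  import Data.Bool.Properties as Bool
  open import Data.Fin using (Fin; zero; suc)
  open import Data.Vec using (Vec; tabulate; lookup)
  open import Data.Vec.Properties using (≡-dec; lookup∘tabulate; tabulate-cong)
  open import Function using (_∘_; mk⇔)
  open import Relation.Binary.PropositionalEquality
  open import Relation.Nullary using (does)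
  open import Relation.Nullary.Decidable using (dec-true; dec-false; does-⇔; decidable-stable)

  open IsEquivalence equivalence using () renaming (refl to ~-refl; sym to ~-sym; trans to ~-trans)

  -- Classes are represented by their characteristic vectors, a colour type with decidable equality.
  classOf : Fin n → Vec Bool n
  classOf e = tabulate (λ z → does (same? e z))

  _≟ᶜ_ : DecidableEquality (Vec Bool n)
  _≟ᶜ_ = ≡-dec Bool._≟_

  classOf-≡⇒Same : ∀ {e f} → classOf e ≡ classOf f → Same e f
  classOf-≡⇒Same {e} {f} eq = decidable-stable (same? e f) λ ¬same → false≢true (begin
    false                 ≡⟨ dec-false (same? e f) ¬same ⟨
    does (same? e f)      ≡⟨ lookup∘tabulate (λ z → does (same? e z)) f ⟨
    lookup (classOf e) f  ≡⟨ cong (λ v → lookup v f) eq ⟩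
    lookup (classOf f) f  ≡⟨ lookup∘tabulate (λ z → does (same? f z)) f ⟩
    does (same? f f)      ≡⟨ dec-true (same? f f) ~-refl ⟩
    true                  ∎)
    where
    open ≡-Reasoning
    false≢true : false ≢ true
    false≢true ()

  Same⇒classOf-≡ : ∀ {e f} → Same e f → classOf e ≡ classOf f
  Same⇒classOf-≡ e~f = tabulate-cong (λ z → does-⇔ (mk⇔ (~-trans (~-sym e~f)) (~-trans e~f)) (same? _ z) (same? _ z))

module RankTwo {n : ℕ} (M : Matroid n) (loopless : ∀ e → ¬ IsLoop M e)
  (coloopless : ∀ e → ¬ IsColoop M e) (rank≡2 : rank M ≡ 2) where

  open import Data.Nat as ℕ using (ℕ; _≤_; _<_; _∸_)
  import Data.Nat.Properties as ℕ
  open import Data.Integer as ℤ using (ℤ; +_)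
  open import Data.Fin using (Fin; _≟_)
  open import Data.Fin.Subset using (∣_∣; _∈_; _∉_; _⊆_; ⁅_⁆)
  open import Data.Fin.Subset.Properties using (∣⁅x⁆∣≡1; x∈⁅y⁆⇒x≡y)
  open import Data.Product using (∃₂; _×_; _,_; proj₁)
  open import Data.Sum using (_⊎_; inj₁; inj₂)
  open import Function using (_∘_)
  open import Relation.Binary.PropositionalEquality
  open import Relation.Nullary using (yes; no; ¬_)
  open import Relation.Nullary.Decidable using (decidable-stable; ¬?; _×-dec_)
  open import Data.Fin.Properties using (any?)
  open import Data.Empty using (⊥-elim)
  open SubsetSums using (sumSubsets-cong)
  open FiniteSubsets
  open MatroidRank

  open Matroid M

  Parallel : Fin n → Fin n → Set
  Parallel e f = e ≡ f ⊎ ¬ Indep (pair e f)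

  parallel? : Decidable Parallel
  parallel? e f with e ≟ f | Indep? (pair e f)
  ... | yes e≡f | _         = yes (inj₁ e≡f)
  ... | no  e≢f | yes indep = no λ { (inj₁ e≡f) → e≢f e≡f ; (inj₂ ¬indep) → ¬indep indep }
  ... | no  _   | no ¬indep = yes (inj₂ ¬indep)

  ¬parallel⇒indep : ∀ {e f} → ¬ Parallel e f → Indep (pair e f)
  ¬parallel⇒indep {e} {f} ¬parallel = decidable-stable (Indep? (pair e f)) (¬parallel ∘ inj₂)

  indep⇒¬parallel : ∀ {e f} → e ≢ f → Indep (pair e f) → ¬ Parallel e f
  indep⇒¬parallel e≢f _     (inj₁ e≡f)    = e≢f e≡f
  indep⇒¬parallel _   indep (inj₂ ¬indep) = ¬indep indep

  parallel-sym : ∀ {e f} → Parallel e f → Parallel f e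
  parallel-sym (inj₁ e≡f)    = inj₁ (sym e≡f)
  parallel-sym (inj₂ ¬indep) = inj₂ (¬indep ∘ indep-hered _ _ pair-comm)

  -- If {e, g} is independent, augmenting {f} from it makes {f, e} or {f, g} independent.
  parallel-trans : ∀ {e f g} → Parallel e f → Parallel f g → Parallel e g
  parallel-trans (inj₁ refl) f~g = f~g
  parallel-trans e~f (inj₁ refl) = e~f
  parallel-trans {e} {f} {g} (inj₂ ¬e,f) (inj₂ ¬f,g) with parallel? e g
  ... | yes e~g = e~g
  ... | no ¬e~g with indep-augment ⁅ f ⁆ (pair e g) (nonloop⇒indep M (loopless f)) (¬parallel⇒indep ¬e~g)
                       (subst (_< ∣ pair e g ∣) (sym (∣⁅x⁆∣≡1 f)) (ℕ.≤-reflexive (sym (∣pair∣≡2 (¬e~g ∘ inj₁)))))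
  ...   | x , x∈ , _ , indep with ∈pair⁻ x∈
  ...     | inj₁ refl = ⊥-elim (¬e,f indep)
  ...     | inj₂ refl = ⊥-elim (¬f,g (indep-hered _ _ pair-comm indep))

  parallel-isEquivalence : IsEquivalence Parallel
  parallel-isEquivalence = record { refl = inj₁ refl ; sym = parallel-sym ; trans = parallel-trans }

  open ClassColouring parallel? parallel-isEquivalence
  open Colouring _≟ᶜ_
  open PaletteBound _≟ᶜ_

  rankOf≡rank₂ : ∀ A → rankOf M A ≡ rank₂ (shape classOf A)
  rankOf≡rank₂ A = by-shape (shape classOf A) (shape-view classOf A)
    where
    by-shape : ∀ κ → ShapeOf classOf A κ → rankOf M A ≡ rank₂ κ
    by-shape empty A-empty =
      ℕ.n≤0⇒n≡0 (rank-≤ M A λ B B⊆A _ → ℕ.≤-reflexive (Empty⇒∣p∣≡0 λ { (x , x∈) → A-empty (x , B⊆A x∈) }))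
    by-shape (mono c) (all-c , x , x∈) = ℕ.≤-antisym (rank-≤ M A at-most-one)
      (subst (_≤ rankOf M A) (∣⁅x⁆∣≡1 x)
        (rank-≥ M A ⁅ x ⁆ (λ y∈ → subst (_∈ A) (sym (x∈⁅y⁆⇒x≡y x y∈)) x∈) (nonloop⇒indep M (loopless x))))
      where
      at-most-one : ∀ B → B ⊆ A → Indep B → ∣ B ∣ ≤ 1
      at-most-one B B⊆A indep with ∣ B ∣ ℕ.≤? 1
      ... | yes ≤1 = ≤1
      ... | no  ≰1 with 2≤∣p∣⇒distinct (ℕ.≰⇒> ≰1)
      ...   | y , z , y∈ , z∈ , y≢z = ⊥-elim (indep⇒¬parallel y≢z (indep-hered B _ (pair⊆ y∈ z∈) indep)
                                        (classOf-≡⇒Same (trans (all-c (B⊆A y∈)) (sym (all-c (B⊆A z∈))))))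
    by-shape multi (x , y , x∈ , y∈ , x≢ᶜy) = ℕ.≤-antisym
      (subst (rankOf M A ≤_) rank≡2 (rankOf≤rank M A))
      (subst (_≤ rankOf M A) (∣pair∣≡2 (¬x~y ∘ inj₁)) (rank-≥ M A (pair x y) (pair⊆ x∈ y∈) (¬parallel⇒indep ¬x~y)))
      where
      ¬x~y : ¬ Parallel x y
      ¬x~y = x≢ᶜy ∘ Same⇒classOf-≡

  stays-multicoloured : StaysMulticoloured classOf
  stays-multicoloured e = decidable-stable
    (any? λ f → any? λ g → ¬? (f ≟ e) ×-dec ¬? (g ≟ e) ×-dec ¬? (classOf f ≟ᶜ classOf g))
    (λ none → noncoloop⇒¬¬avoiding-basis M (coloopless e) λ { (B , basis , e∉B) → none (two-in B basis e∉B) })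
    where
    two-in : ∀ B → IsBasis M B → e ∉ B → ∃₂ λ f g → f ≢ e × g ≢ e × classOf f ≢ classOf g
    two-in B basis e∉B with 2≤∣p∣⇒distinct (ℕ.≤-reflexive (sym (trans (basis-size M basis) rank≡2)))
    ... | f , g , f∈ , g∈ , f≢g = f , g , (λ { refl → e∉B f∈ }) , (λ { refl → e∉B g∈ }) ,
          indep⇒¬parallel f≢g (indep-hered B _ (pair⊆ f∈ g∈) (proj₁ basis)) ∘ classOf-≡⇒Same

  tutte≡rank2Sum : ∀ x y → tutte M x y ≡ rank2Sum classOf (x ℤ.- + 1) (y ℤ.- + 1)
  tutte≡rank2Sum x y = sumSubsets-cong λ A →
    cong₂ (λ r ρ → (x ℤ.- + 1) ℤ.^ (r ∸ ρ) ℤ.* (y ℤ.- + 1) ℤ.^ (∣ A ∣ ∸ ρ)) rank≡2 (rankOf≡rank₂ A)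

  tutte-bound : tutte M (+ 1) (+ 1) ℤ.* tutte M (+ 1) (+ 1) ℤ.≤ tutte M (+ 2) (+ 0) ℤ.* tutte M (+ 0) (+ 2)
  tutte-bound = subst₂ ℤ._≤_
    (sym (cong₂ ℤ._*_ (tutte≡rank2Sum (+ 1) (+ 1)) (tutte≡rank2Sum (+ 1) (+ 1))))
    (sym (cong₂ ℤ._*_ (tutte≡rank2Sum (+ 2) (+ 0)) (tutte≡rank2Sum (+ 0) (+ 2))))
    (rank2Sum-bound classOf stays-multicoloured)

module CorankTwo {n : ℕ} (M : Matroid n) (loopless : ∀ e → ¬ IsLoop M e)
  (coloopless : ∀ e → ¬ IsColoop M e) (corank≡2 : corank M ≡ 2) where

  open import Data.Nat as ℕ using (ℕ; suc; _≤_; _<_; s≤s; z≤n; _∸_; _+_)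
  import Data.Nat.Properties as ℕ
  open import Data.Integer as ℤ using (ℤ; +_; -[1+_])
  import Data.Integer.Properties as ℤ
  open import Data.Fin using (Fin; _≟_)
  open import Data.Fin.Properties using (any?)
  open import Data.Fin.Subset using (Subset; ∣_∣; _∈_; _∉_; _⊆_; ⁅_⁆; _∪_; ⊤; ∁; _-_)
  open import Data.Fin.Subset.Properties using (x∈⁅x⁆; x∈p∪q⁺; x∈∁p⇒x∉p; x∉p⇒x∈∁p; x∉∁p⇒x∈p; _∈?_; x∈p∧x≢y⇒x∈p-y)
  open import Data.Product using (∃; ∃₂; _×_; _,_; proj₁; proj₂)
  open import Data.Sum using (_⊎_; inj₁; inj₂)
  open import Function using (_∘_; id; flip)
  open import Relation.Binary.PropositionalEquality
  open import Relation.Nullary using (yes; no; ¬_)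
  open import Relation.Nullary.Decidable using (decidable-stable; ¬?; _×-dec_)
  open import Data.Empty using (⊥; ⊥-elim)
  open Arithmetic using (complement-exponents)
  open SubsetSums using (sumSubsets-cong; sumSubsets-∁)
  open FiniteSubsets
  open MatroidRank

  open Matroid M

  n≡rank+2 : n ≡ rank M + 2
  n≡rank+2 = trans (sym (ℕ.m∸n+n≡m (rank≤n M))) (trans (cong (_+ rank M) corank≡2) (ℕ.+-comm 2 (rank M)))

  ∣J∣≡rank⇒∣∁J∣≡2 : ∀ {J} → ∣ J ∣ ≡ rank M → ∣ ∁ J ∣ ≡ 2
  ∣J∣≡rank⇒∣∁J∣≡2 {J} ∣J∣≡ = ℕ.+-cancelʳ-≡ (rank M) _ _
    (trans (cong (_+_ ∣ ∁ J ∣) (sym ∣J∣≡)) (trans (∣∁p∣+∣p∣≡n J) (trans n≡rank+2 (ℕ.+-comm (rank M) 2))))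

  ∣∁pair∣≡rank : ∀ {e f} → e ≢ f → ∣ ∁ (pair e f) ∣ ≡ rank M
  ∣∁pair∣≡rank {e} {f} e≢f = ℕ.+-cancelʳ-≡ 2 _ _
    (trans (cong (_+_ ∣ ∁ (pair e f) ∣) (sym (∣pair∣≡2 e≢f))) (trans (∣∁p∣+∣p∣≡n (pair e f)) n≡rank+2))

  rank-sized⇒∁pair⊆ : ∀ {J e} → ∣ J ∣ ≡ rank M → e ∉ J → ∃ λ h → h ≢ e × h ∉ J × ∁ (pair e h) ⊆ J
  rank-sized⇒∁pair⊆ {J} {e} ∣J∣≡ e∉J with ∣p∣≡2⇒pair {p = ∁ J} (∣J∣≡rank⇒∣∁J∣≡2 {J = J} ∣J∣≡) (x∉p⇒x∈∁p e∉J)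
  ... | h , h≢e , h∈∁J , only = h , h≢e , x∈∁p⇒x∉p h∈∁J , ∁pair⊆J
    where
    ∁pair⊆J : ∁ (pair e h) ⊆ J
    ∁pair⊆J {z} z∈ with z ∈? J
    ... | yes z∈J = z∈J
    ... | no  z∉J with only (x∉p⇒x∈∁p z∉J)
    ...   | inj₁ z≡e = ⊥-elim (proj₁ (∉∁pair z∈) z≡e)
    ...   | inj₂ z≡h = ⊥-elim (proj₂ (∉∁pair z∈) z≡h)

  partner : ∀ e → ∃ λ h → h ≢ e × Indep (∁ (pair e h))
  partner e = decidable-stable (any? λ h → ¬? (h ≟ e) ×-dec Indep? (∁ (pair e h)))
    (λ none → noncoloop⇒¬¬avoiding-basis M (coloopless e) λ { (B , basis , e∉B) → none (from-basis B basis e∉B) })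
    where
    from-basis : ∀ B → IsBasis M B → e ∉ B → ∃ λ h → h ≢ e × Indep (∁ (pair e h))
    from-basis B basis e∉B =
      let h , h≢e , _ , ⊆B = rank-sized⇒∁pair⊆ {J = B} (basis-size M basis) e∉B
      in h , h≢e , indep-hered B _ ⊆B (proj₁ basis)

  Series : Fin n → Fin n → Set
  Series e f = e ≡ f ⊎ ¬ Indep (∁ (pair e f))

  series? : Decidable Series
  series? e f with e ≟ f | Indep? (∁ (pair e f))
  ... | yes e≡f | _         = yes (inj₁ e≡f)
  ... | no  e≢f | yes indep = no λ { (inj₁ e≡f) → e≢f e≡f ; (inj₂ ¬indep) → ¬indep indep }
  ... | no  _   | no ¬indep = yes (inj₂ ¬indep)

  ¬series⇒indep : ∀ {e f} → ¬ Series e f → Indep (∁ (pair e f))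
  ¬series⇒indep {e} {f} ¬series = decidable-stable (Indep? (∁ (pair e f))) (¬series ∘ inj₂)

  indep⇒¬series : ∀ {e f} → e ≢ f → Indep (∁ (pair e f)) → ¬ Series e f
  indep⇒¬series e≢f _     (inj₁ e≡f)    = e≢f e≡f
  indep⇒¬series _   indep (inj₂ ¬indep) = ¬indep indep

  series-sym : ∀ {e f} → Series e f → Series f e
  series-sym (inj₁ e≡f)    = inj₁ (sym e≡f)
  series-sym (inj₂ ¬indep) = inj₂ (¬indep ∘ indep-hered _ _ (∁-antitone pair-comm))

  -- Augmenting ∁{e,g} - f from a basis ∁{f,h} can only add back e or g,
  -- which makes ∁{f,g} or ∁{e,f} independent.
  series-trans : ∀ {e f g} → Series e f → Series f g → Series e g
  series-trans (inj₁ refl) f~g = f~g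
  series-trans e~f (inj₁ refl) = e~f
  series-trans {e} {f} {g} (inj₂ ¬e,f) (inj₂ ¬f,g) with series? e g | f ≟ e | f ≟ g
  ... | yes e~g | _        | _        = e~g
  ... | no ¬e~g | yes refl | _        = ⊥-elim (¬e~g (inj₂ ¬f,g))
  ... | no ¬e~g | no _     | yes refl = ⊥-elim (¬e~g (inj₂ ¬e,f))
  ... | no ¬e~g | no f≢e   | no f≢g   with partner f
  ...   | h , h≢f , indep-fh with indep-augment I (∁ (pair f h)) indepI indep-fh ∣I∣<
    where
    I = ∁ (pair e g) - f
    f∈∁eg : f ∈ ∁ (pair e g)
    f∈∁eg = ∈∁pair f≢e f≢g
    indepI : Indep I
    indepI = indep-hered _ I (x∈p-y⇒x∈p {y = f}) (¬series⇒indep ¬e~g)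
    ∣I∣< : ∣ I ∣ < ∣ ∁ (pair f h) ∣
    ∣I∣< = subst₂ _≤_ (∣p∣≡1+∣p-x∣ f∈∁eg)
      (trans (∣∁pair∣≡rank (¬e~g ∘ inj₁)) (sym (∣∁pair∣≡rank (h≢f ∘ sym)))) ℕ.≤-refl
  ...     | x , x∈ , x∉I , indep′ = ⊥-elim (added (∈pair⁻ (x∉∁p⇒x∈p (x∉I ∘ flip x∈p∧x≢y⇒x∈p-y x≢f))))
    where
    x≢f : x ≢ f
    x≢f = proj₁ (∉∁pair x∈)
    covered : ∀ {z} → z ≢ f → (z ≡ e ⊎ z ≡ g → z ≡ x) → z ∈ ⁅ x ⁆ ∪ (∁ (pair e g) - f)
    covered {z} z≢f to-x with z ≟ x
    ... | yes refl = x∈p∪q⁺ (inj₁ (x∈⁅x⁆ z))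
    ... | no  z≢x  = x∈p∪q⁺ (inj₂ (x∈p∧x≢y⇒x∈p-y (∈∁pair (z≢x ∘ to-x ∘ inj₁) (z≢x ∘ to-x ∘ inj₂)) z≢f))
    added : x ≡ e ⊎ x ≡ g → ⊥
    added (inj₁ refl) = ¬f,g (indep-hered _ _ (λ z∈ → let z≢f , z≢g = ∉∁pair z∈ in
                          covered z≢f λ { (inj₁ z≡x) → z≡x ; (inj₂ z≡g) → ⊥-elim (z≢g z≡g) }) indep′)
    added (inj₂ refl) = ¬e,f (indep-hered _ _ (λ z∈ → let z≢e , z≢f = ∉∁pair z∈ in
                          covered z≢f λ { (inj₁ z≡e) → ⊥-elim (z≢e z≡e) ; (inj₂ z≡x) → z≡x }) indep′)

  series-isEquivalence : IsEquivalence Series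
  series-isEquivalence = record { refl = inj₁ refl ; sym = series-sym ; trans = series-trans }

  open ClassColouring series? series-isEquivalence
  open Colouring _≟ᶜ_
  open PaletteBound _≟ᶜ_

  rank-sized⇒¬series-pair : ∀ {J} → Indep J → ∣ J ∣ ≡ rank M → ∃₂ λ f g → f ∉ J × g ∉ J × ¬ Series f g
  rank-sized⇒¬series-pair {J} indepJ ∣J∣≡
    with 1≤∣p∣⇒Nonempty {p = ∁ J} (subst (1 ≤_) (sym (∣J∣≡rank⇒∣∁J∣≡2 {J = J} ∣J∣≡)) (s≤s z≤n))
  ... | f , f∈∁J with rank-sized⇒∁pair⊆ {J = J} ∣J∣≡ (x∈∁p⇒x∉p f∈∁J)
  ...   | g , g≢f , g∉J , ⊆J =
    f , g , x∈∁p⇒x∉p f∈∁J , g∉J , indep⇒¬series (g≢f ∘ sym) (indep-hered J _ ⊆J indepJ)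

  series-class⇒∁-dependent : ∀ {C} → (∀ {y z} → y ∈ C → z ∈ C → Series y z) → ¬ Indep (∁ C)
  series-class⇒∁-dependent {C} all-series indep with extend-to-rank M indep
  ... | J , ∁C⊆J , indepJ , ∣J∣≡ with rank-sized⇒¬series-pair indepJ ∣J∣≡
  ...   | f , g , f∉J , g∉J , ¬f~g = ¬f~g (all-series (outside f∉J) (outside g∉J))
    where
    outside : ∀ {z} → z ∉ J → z ∈ C
    outside z∉J = x∉∁p⇒x∈p (z∉J ∘ ∁C⊆J)

  -- Series classes are the parallel classes of the dual matroid.
  rankOf-∁ : ∀ C → rankOf M (∁ C) + (2 ∸ rank₂ (shape classOf C)) ≡ ∣ ∁ C ∣
  rankOf-∁ C = by-shape (shape classOf C) (shape-view classOf C)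
    where
    by-shape : ∀ κ → ShapeOf classOf C κ → rankOf M (∁ C) + (2 ∸ rank₂ κ) ≡ ∣ ∁ C ∣
    by-shape empty C-empty = begin
      rankOf M (∁ C) + 2   ≡⟨ cong (_+ 2) full-rank ⟩
      rank M + 2           ≡⟨ n≡rank+2 ⟨
      n                    ≡⟨ ∣∁p∣+∣p∣≡n C ⟨
      ∣ ∁ C ∣ + ∣ C ∣      ≡⟨ cong (_+_ ∣ ∁ C ∣) (Empty⇒∣p∣≡0 C-empty) ⟩
      ∣ ∁ C ∣ + 0          ≡⟨ ℕ.+-identityʳ _ ⟩
      ∣ ∁ C ∣              ∎
      where
      open ≡-Reasoning
      full-rank : rankOf M (∁ C) ≡ rank M
      full-rank with rank-attained M ⊤
      ... | W , (_ , indepW) , eq = ℕ.≤-antisym (rankOf≤rank M (∁ C))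
        (subst (_≤ rankOf M (∁ C)) (sym eq)
          (rank-≥ M (∁ C) W (λ {x} _ → x∉p⇒x∈∁p (λ x∈C → C-empty (x , x∈C))) indepW))
    by-shape (mono c) (all-c , x , x∈C) with partner x
    ... | y , y≢x , indep-xy = ℕ.≤-antisym
      (subst (_≤ ∣ ∁ C ∣) (ℕ.+-comm 1 _) (dependent⇒rankOf<∣∣ M (series-class⇒∁-dependent λ y∈ z∈ →
        classOf-≡⇒Same (trans (all-c y∈) (sym (all-c z∈))))))
      (subst₂ _≤_ (sym (∣p∣≡1+∣p-x∣ y∈∁C)) (ℕ.+-comm 1 _) (s≤s almost-indep))
      where
      y∈∁C : y ∈ ∁ C
      y∈∁C = x∉p⇒x∈∁p λ y∈C →
        indep⇒¬series (y≢x ∘ sym) indep-xy (classOf-≡⇒Same (trans (all-c x∈C) (sym (all-c y∈C))))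
      ∁C-y⊆ : ∁ C - y ⊆ ∁ (pair x y)
      ∁C-y⊆ {z} z∈ = ∈∁pair (λ { refl → x∈∁p⇒x∉p (x∈p-y⇒x∈p {y = y} z∈) x∈C }) (x∈p-y⇒x≢y z∈)
      almost-indep : ∣ ∁ C - y ∣ ≤ rankOf M (∁ C)
      almost-indep = rank-≥ M (∁ C) (∁ C - y) (x∈p-y⇒x∈p {y = y}) (indep-hered _ _ ∁C-y⊆ indep-xy)
    by-shape multi (x , y , x∈C , y∈C , x≢ᶜy) = trans (ℕ.+-identityʳ _)
      (ℕ.≤-antisym (rankOf≤∣∣ M (∁ C)) (rank-≥ M (∁ C) (∁ C) id
        (indep-hered _ (∁ C) (∁-antitone (pair⊆ x∈C y∈C)) (¬series⇒indep (x≢ᶜy ∘ Same⇒classOf-≡)))))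

  stays-multicoloured : StaysMulticoloured classOf
  stays-multicoloured e with extend-to-rank M (nonloop⇒indep M (loopless e))
  ... | J , e⊆J , indepJ , ∣J∣≡ with rank-sized⇒¬series-pair indepJ ∣J∣≡
  ...   | f , g , f∉J , g∉J , ¬f~g = f , g , avoids-e f∉J , avoids-e g∉J , ¬f~g ∘ classOf-≡⇒Same
    where
    avoids-e : ∀ {z} → z ∉ J → z ≢ e
    avoids-e z∉J refl = z∉J (e⊆J (x∈⁅x⁆ _))

  tutte≡rank2Sum : ∀ x y → tutte M x y ≡ rank2Sum classOf (y ℤ.- + 1) (x ℤ.- + 1)
  tutte≡rank2Sum x y = trans (sumSubsets-∁ {n} term) (sumSubsets-cong {n} swap)
    where
    term : Subset n → ℤ
    term A = (x ℤ.- + 1) ℤ.^ (rank M ∸ rankOf M A) ℤ.* (y ℤ.- + 1) ℤ.^ (∣ A ∣ ∸ rankOf M A)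
    swap : ∀ C → term (∁ C) ≡ rank2Term (y ℤ.- + 1) (x ℤ.- + 1) (shape classOf C) ∣ C ∣
    swap C with complement-exponents (trans (∣∁p∣+∣p∣≡n C) n≡rank+2) (rankOf-∁ C)
                  (fits⇒rank₂≤ (shape-fits classOf C)) (rank₂≤2 (shape classOf C))
    ... | R∸r≡ , a∸r≡ = trans (cong₂ (λ a b → (x ℤ.- + 1) ℤ.^ a ℤ.* (y ℤ.- + 1) ℤ.^ b) R∸r≡ a∸r≡)
                                (ℤ.*-comm ((x ℤ.- + 1) ℤ.^ (∣ C ∣ ∸ ρ)) ((y ℤ.- + 1) ℤ.^ (2 ∸ ρ)))
      where ρ = rank₂ (shape classOf C)

  tutte-bound : tutte M (+ 1) (+ 1) ℤ.* tutte M (+ 1) (+ 1) ℤ.≤ tutte M (+ 2) (+ 0) ℤ.* tutte M (+ 0) (+ 2)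
  tutte-bound = subst₂ ℤ._≤_
    (sym (cong₂ ℤ._*_ (tutte≡rank2Sum (+ 1) (+ 1)) (tutte≡rank2Sum (+ 1) (+ 1))))
    (trans (ℤ.*-comm (rank2Sum classOf (+ 1) -[1+ 0 ]) (rank2Sum classOf -[1+ 0 ] (+ 1)))
      (sym (cong₂ ℤ._*_ (tutte≡rank2Sum (+ 2) (+ 0)) (tutte≡rank2Sum (+ 0) (+ 2)))))
    (rank2Sum-bound classOf stays-multicoloured)

open import Data.Integer using (ℤ; +_; _*_; _≤_)
open import Data.Sum using (_⊎_; inj₁; inj₂)

lemma2p7 : (n : ℕ) (M : Matroid n) →
    (∀ (e : Fin n) → ¬ IsLoop M e) →
    (∀ (e : Fin n) → ¬ IsColoop M e) →
    (rank M ≡ 2 ⊎ corank M ≡ 2) →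
    tutte M (+ 1) (+ 1) * tutte M (+ 1) (+ 1) ≤ tutte M (+ 2) (+ 0) * tutte M (+ 0) (+ 2)
lemma2p7 n M loopless coloopless (inj₁ rank≡2)   = RankTwo.tutte-bound M loopless coloopless rank≡2
lemma2p7 n M loopless coloopless (inj₂ corank≡2) = CorankTwo.tutte-bound M loopless coloopless corank≡2
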